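{- Let $P$ be a balanced partition of $T$ such that for some $i\leq n-2$, $\mathcal{C}_{<i}\subseteq P_1\subseteq\mathcal{C}_{\leq i}$. Then there exists a sequence of recombination steps through balanced partitions producing the ground state $\sigma_{123}$.
   Context: $G_\Delta$ is the infinite triangular lattice; $T$ is an equilateral triangular subgraph of $G_\Delta$ with $n\ge 5$ vertices on each side, oriented so its right side is vertical. $\mathcal{C}_m$ is the set of vertices in the $m$-th vertical column from the left ($\mathcal{C}_1$ is the leftmost corner vertex); $\mathcal{C}_{<i}=\bigcup_{m<i}\mathcal{C}_m$, $\mathcal{C}_{\le i}=\bigcup_{m\le i}\mathcal{C}_m$. Integers $k_1,k_2,k_3\ge n$ satisfy $k_1+k_2+k_3=n(n+1)/2$. A partition of $T$ is a partition of $V(T)$ into three labelled simply connected districts $P_1,P_2,P_3$ (each induces a connected subgraph and no cycle of $G_\Delta$ made of its vertices encloses a vertex not in it); it is balanced if $|P_m|=k_m$ for all $m$. Order the vertices of $T$ column by column from left to right, and within each column from top to bottom. The ground state $\sigma_{123}$ is the partition whose first $k_1$ vertices in this order form $P_1$, next $k_2$ form $P_2$, and last $k_3$ form $P_3$. A recombination step changes a partition to another one agreeing with it on at least one district. -}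

module Defs where

open import Data.Nat using (ℕ; zero; suc; _+_; _*_; _∸_; _≤_; _<_; _≤ᵇ_; _<ᵇ_; _%_; _/_)
open import Data.Fin using (Fin; toℕ; zero; suc)
open import Data.Fin.Properties using () renaming (_≟_ to _≟F_)
open import Data.Bool using (Bool; true; false; _∧_; _∨_; not; if_then_else_)
open import Data.List using (List; []; _∷_; _++_; [_]; map; concatMap; length; filter; zip; allFin)
open import Data.List.Relation.Unary.All using (All)
open import Data.List.Relation.Unary.Unique.Propositional using (Unique)
open import Data.Product using (Σ; _×_; _,_; proj₁; proj₂; ∃)
open import Data.Sum using (_⊎_)
open import Relation.Binary.PropositionalEquality using (_≡_)
open import Relation.Binary.Construct.Closure.ReflexiveTransitive using (Star)
open import Relation.Unary using (Pred)
open import Level using (0ℓ)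

-- The triangle T with n vertices per side, right side vertical, has
-- columns 1..n (left to right); column m has m vertices.  A vertex is
-- (c , r) with c : Fin n the 0-based column index (so it lies in the
-- column C_(c+1)) and r : Fin (c+1) the 0-based row from the top.
-- Embedding in G_Δ: vertex (c , r) sits at the point
--   x = c·(√3/2),  y = (c − 2r)/2 .

V : ℕ → Set
V n = Σ (Fin n) (λ c → Fin (suc (toℕ c)))

col : ∀ {n} → V n → ℕ
col (c , _) = toℕ c

row : ∀ {n} → V n → ℕ
row (_ , r) = toℕ r

allV : (n : ℕ) → List (V n)
allV n = concatMap (λ c → map (λ r → (c , r)) (allFin _)) (allFin n)

Step : ∀ {n} → V n → V n → Set
Step a b = (col a ≡ col b × suc (row a) ≡ row b)
         ⊎ (suc (col a) ≡ col b × (row b ≡ row a ⊎ row b ≡ suc (row a)))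

Adj : ∀ {n} → V n → V n → Set
Adj a b = Step a b ⊎ Step b a

District : ℕ → Set₁
District n = Pred (V n) 0ℓ

Connected : ∀ {n} → District n → Set
Connected {n} S = ∀ u v → S u → S v →
  Star (λ a b → Adj a b × S a × S b) u v

cycEdges : ∀ {n} → List (V n) → List (V n × V n)
cycEdges [] = []
cycEdges (x ∷ xs) = zip (x ∷ xs) (xs ++ [ x ])

IsCycle : ∀ {n} → List (V n) → Set
IsCycle vs = 3 ≤ length vs × Unique vs × All (λ e → Adj (proj₁ e) (proj₂ e)) (cycEdges vs)

-- "Y a ≤ Y w" where Y = c − 2r is twice the height
lowerEq : ∀ {n} → V n → V n → Bool
lowerEq a w = (col a + 2 * row w) ≤ᵇ (col w + 2 * row a)

-- Does the horizontal ray from w to the right (at height infinitesimally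
-- above w, so that it meets no lattice point) cross the segment ab ?
crosses : ∀ {n} → V n → V n → V n → Bool
crosses w a b =
     (lowerEq a w ∧ not (lowerEq b w) ∧ (col w <ᵇ col a))
   ∨ (lowerEq b w ∧ not (lowerEq a w) ∧ (col w <ᵇ col b))

crossCount : ∀ {n} → V n → List (V n × V n) → ℕ
crossCount w [] = 0
crossCount w ((a , b) ∷ es) =
  (if crosses w a b then 1 else 0) + crossCount w es

-- the polygon of the cycle vs encloses w (ray-casting / even–odd rule)
Encloses : ∀ {n} → List (V n) → V n → Set
Encloses vs w = crossCount w (cycEdges vs) % 2 ≡ 1

SimplyConnected : ∀ {n} → District n → Set
SimplyConnected {n} S = ∀ (vs : List (V n)) → IsCycle vs → All S vs →
  ∀ w → Encloses vs w → S w

-- Partitions: a labelling of V(T) by Fin 3 (label zero = P₁, etc.).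

Labelling : ℕ → Set
Labelling n = V n → Fin 3

Dist : ∀ {n} → Labelling n → Fin 3 → District n
Dist P m v = P v ≡ m

IsPartition : ∀ {n} → Labelling n → Set
IsPartition P = ∀ m → Connected (Dist P m) × SimplyConnected (Dist P m)

size : ∀ {n} → Labelling n → Fin 3 → ℕ
size {n} P m = length (filter (λ v → P v ≟F m) (allV n))

IsBalanced : ∀ {n} → (k : Fin 3 → ℕ) → Labelling n → Set
IsBalanced k P = IsPartition P × (∀ m → size P m ≡ k m)

AgreeOn : ∀ {n} → Labelling n → Labelling n → Fin 3 → Set
AgreeOn {n} P Q m = ∀ (v : V n) → (P v ≡ m → Q v ≡ m) × (Q v ≡ m → P v ≡ m)

RecomStep : ∀ {n} → (Fin 3 → ℕ) → Labelling n → Labelling n → Set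
RecomStep k P Q = IsBalanced k Q × ∃ (λ m → AgreeOn P Q m)

-- 0-based position of (c , r) in the column-by-column, top-to-bottom order
index : ∀ {n} → V n → ℕ
index v = (col v * suc (col v)) / 2 + row v

σ123 : ∀ {n} → (Fin 3 → ℕ) → Labelling n
σ123 k v =
  if index v <ᵇ k zero then zero
  else if index v <ᵇ (k zero + k (suc zero)) then suc zero
  else suc (suc zero)

-- Columns (1-based as in the paper): v ∈ C_m  iff  col v + 1 = m.

InColsBelow : ∀ {n} → ℕ → V n → Set
InColsBelow i v = suc (col v) < i

InColsUpTo : ∀ {n} → ℕ → V n → Set
InColsUpTo i v = suc (col v) ≤ i

module Submission where

-- Let c₀ be the column carrying the boundary of P₁. All partitions on the way are
-- staircases: the columns left of c₀ form P₁, column c₀ carries some pattern, and the vertices right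
-- of it are cut in the column-by-column order into an initial segment P₂ and the rest P₃. Such a
-- labelling is a partition as soon as the P₂ cells of column c₀ hang from one adjacent to the P₂
-- segment and the P₃ cells of column c₀ touch the P₃ segment: connectivity comes from explicit paths,
-- simple connectivity from the parity of the crossings of a horizontal ray from a vertex outside.
-- Keeping P₁ we pass from P to a staircase; keeping in turn P₃, P₂ and P₃ we sort column c₀ into
-- blocks P₁, P₂, P₃; keeping P₁ we finally move the cut and arrive at σ₁₂₃. Balance is preserved by
-- choosing where the P₂ block of column c₀ ends together with the length of the P₂ segment, by a
-- discrete intermediate value argument.

open import Defs
open import Data.Bool using (Bool; true; false; not; _∧_; _∨_; _xor_; if_then_else_; T)
open import Data.Empty using (⊥; ⊥-elim)
open import Data.Fin using (Fin; zero; toℕ; fromℕ<) renaming (suc to fsuc)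
open import Data.Fin.Properties using (toℕ<n; toℕ-fromℕ<; toℕ-injective) renaming (_≟_ to _≟F_)
open import Data.List using (List; []; _∷_; _++_; [_]; map; concatMap; zip; length; filter; allFin)
open import Data.List.Properties using (length-++; filter-++; map-tabulate)
open import Data.List.Relation.Unary.All as All using (All; []; _∷_)
open import Data.List.Relation.Unary.All.Properties using (++⁺)
open import Data.Nat using (ℕ; zero; suc; _+_; _*_; _∸_; _≤_; _<_; z≤n; s≤s; s≤s⁻¹; z<s; s<s; _<ᵇ_; _≤ᵇ_; _⊓_; _/_; _%_; pred; parity; nonZero)
open import Data.Nat.DivMod using (m*n/n≡m; [m+n]%n≡m%n)
open import Data.Nat.Properties
open import Data.Nat.Tactic.RingSolver using (solve-∀)
open import Data.Parity using (Parity; 0ℙ; 1ℙ) renaming (_+_ to _⊕_)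
open import Data.Parity.Properties using (+-homo-+) renaming (+-identityʳ to ⊕-identityʳ; +-assoc to ⊕-assoc; p+p≡0ℙ to ⊕-self)
open import Data.Product using (Σ; _×_; _,_; proj₁; proj₂; ∃)
open import Data.Sum using (_⊎_; inj₁; inj₂)
open import Function using (_∘_; id)
open import Relation.Binary using (tri<; tri≈; tri>)
open import Relation.Binary.Construct.Closure.ReflexiveTransitive using (Star; ε; _◅_; _◅◅_; reverse)
open import Relation.Binary.PropositionalEquality hiding ([_])
open import Relation.Nullary using (¬_; Dec; yes; no; does)

pattern L₁ = zero
pattern L₂ = fsuc zero
pattern L₃ = fsuc (fsuc zero)

bit : Bool → ℕ
bit b = if b then 1 else 0

module _ {m n : ℕ} where

  ≤ᵇ-true⇒≤ : (m ≤ᵇ n) ≡ true → m ≤ n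
  ≤ᵇ-true⇒≤ e = ≤ᵇ⇒≤ m n (subst T (sym e) _)

  ≤ᵇ-false⇒≰ : (m ≤ᵇ n) ≡ false → ¬ (m ≤ n)
  ≤ᵇ-false⇒≰ e m≤n = subst T e (≤⇒≤ᵇ m≤n)

  <ᵇ-true⇒< : (m <ᵇ n) ≡ true → m < n
  <ᵇ-true⇒< e = <ᵇ⇒< m n (subst T (sym e) _)

  <ᵇ-false⇒≥ : (m <ᵇ n) ≡ false → n ≤ m
  <ᵇ-false⇒≥ e = ≮⇒≥ λ m<n → subst T e (<⇒<ᵇ m<n)

  <⇒<ᵇ-true : m < n → (m <ᵇ n) ≡ true
  <⇒<ᵇ-true m<n with m <ᵇ n in e
  ... | true  = refl
  ... | false = ⊥-elim (<⇒≱ m<n (<ᵇ-false⇒≥ e))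

  ≥⇒<ᵇ-false : n ≤ m → (m <ᵇ n) ≡ false
  ≥⇒<ᵇ-false n≤m with m <ᵇ n in e
  ... | true  = ⊥-elim (<⇒≱ (<ᵇ-true⇒< e) n≤m)
  ... | false = refl

<ᵇ-+-cancelˡ : ∀ a b c → (a + b <ᵇ a + c) ≡ (b <ᵇ c)
<ᵇ-+-cancelˡ zero    b c = refl
<ᵇ-+-cancelˡ (suc a) b c = <ᵇ-+-cancelˡ a b c

-- Triangular numbers and the column-by-column order

tri : ℕ → ℕ
tri zero    = 0
tri (suc c) = tri c + suc c

tri-mono-≤ : ∀ {a b} → a ≤ b → tri a ≤ tri b
tri-mono-≤ {zero}          _         = z≤n
tri-mono-≤ {suc a} {suc b} (s≤s a≤b) = +-mono-≤ (tri-mono-≤ a≤b) (s≤s a≤b)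

tri*2 : ∀ c → tri c * 2 ≡ c * suc c
tri*2 zero    = refl
tri*2 (suc c) = begin
  (tri c + suc c) * 2          ≡⟨ *-distribʳ-+ 2 (tri c) (suc c) ⟩
  tri c * 2 + suc c * 2        ≡⟨ cong (_+ suc c * 2) (tri*2 c) ⟩
  c * suc c + suc c * 2        ≡⟨ cong (_+ suc c * 2) (*-comm c (suc c)) ⟩
  suc c * c + suc c * 2        ≡⟨ *-distribˡ-+ (suc c) c 2 ⟨
  suc c * (c + 2)              ≡⟨ cong (suc c *_) (+-comm c 2) ⟩
  suc c * suc (suc c)          ∎
  where open ≡-Reasoning

module _ {n : ℕ} where

  row≤col : (v : V n) → row v ≤ col v
  row≤col (c , r) = s≤s⁻¹ (toℕ<n r)

  col<n : (v : V n) → col v < n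
  col<n (c , r) = toℕ<n c

  ≡-byCoords : {u v : V n} → col u ≡ col v → row u ≡ row v → u ≡ v
  ≡-byCoords {c , r} {c′ , r′} e₁ e₂ with toℕ-injective e₁
  ... | refl = cong (c ,_) (toℕ-injective e₂)

  VertexAt : ℕ → ℕ → Set
  VertexAt c r = Σ (V n) λ v → col v ≡ c × row v ≡ r

  vertexAt : ∀ {c r} → c < n → r ≤ c → VertexAt c r
  vertexAt c<n r≤c =
    (fromℕ< c<n , fromℕ< (s≤s (subst (_ ≤_) (sym (toℕ-fromℕ< c<n)) r≤c))) ,
    toℕ-fromℕ< c<n , toℕ-fromℕ< _

  vertexAt-≡ : ∀ {c r} (c<n : c < n) (r≤c : r ≤ c) (v : V n) → col v ≡ c → row v ≡ r → proj₁ (vertexAt c<n r≤c) ≡ v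
  vertexAt-≡ c<n r≤c v ec er =
    ≡-byCoords (trans (proj₁ (proj₂ (vertexAt c<n r≤c))) (sym ec)) (trans (proj₂ (proj₂ (vertexAt c<n r≤c))) (sym er))

  rank : V n → ℕ
  rank v = tri (col v) + row v

  index≡rank : (v : V n) → index v ≡ rank v
  index≡rank v = cong (_+ row v) (begin
    col v * suc (col v) / 2  ≡⟨ cong (_/ 2) (tri*2 (col v)) ⟨
    tri (col v) * 2 / 2      ≡⟨ m*n/n≡m (tri (col v)) 2 ⟩
    tri (col v)              ∎)
    where open ≡-Reasoning

  tri≤rank : (v : V n) → tri (col v) ≤ rank v
  tri≤rank v = m≤m+n (tri (col v)) (row v)

  rank<tri-suc : (v : V n) → rank v < tri (suc (col v))
  rank<tri-suc v = +-monoʳ-< (tri (col v)) (s≤s (row≤col v))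

  rank<tri⇒col< : (v : V n) {c : ℕ} → rank v < tri c → col v < c
  rank<tri⇒col< v {c} lt = ≰⇒> λ c≤col → <⇒≱ lt (≤-trans (tri-mono-≤ c≤col) (tri≤rank v))

  rank<⇒col≤ : (u v : V n) → rank u < rank v → col u ≤ col v
  rank<⇒col≤ u v lt = s≤s⁻¹ (rank<tri⇒col< u (<-trans lt (rank<tri-suc v)))

  rank-mono-row : (u v : V n) → col u ≡ col v → row u ≤ row v → rank u ≤ rank v
  rank-mono-row u v ec le = subst (λ c → rank u ≤ tri c + row v) ec (+-monoʳ-≤ (tri (col u)) le)

  rank≤rank-diagonal : (v w : V n) → col v ≤ col w → row w ≡ col w → rank v ≤ rank w
  rank≤rank-diagonal v w le ew = begin
    tri (col v) + row v   ≤⟨ +-mono-≤ (tri-mono-≤ le) (≤-trans (row≤col v) le) ⟩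
    tri (col w) + col w   ≡⟨ cong (tri (col w) +_) ew ⟨
    tri (col w) + row w   ∎
    where open ≤-Reasoning

-- Paths along lattice lines

module _ {n : ℕ} where

  Path : District n → V n → V n → Set
  Path S = Star (λ a b → Adj a b × S a × S b)

  Adj-sym : {a b : V n} → Adj a b → Adj b a
  Adj-sym (inj₁ s) = inj₂ s
  Adj-sym (inj₂ s) = inj₁ s

  Path-sym : {S : District n} {u v : V n} → Path S u v → Path S v u
  Path-sym = reverse λ (adj , Sa , Sb) → Adj-sym adj , Sb , Sa

  connected-viaAnchor : (S : District n) (o : V n) → (∀ v → S v → Path S v o) → Connected S
  connected-viaAnchor S o toAnchor u v Su Sv = toAnchor u Su ◅◅ Path-sym (toAnchor v Sv)

data Dir : Set where
  vertical horizontal diagonal : Dir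

Δcol Δrow : Dir → ℕ
Δcol vertical = 0
Δcol _        = 1
Δrow horizontal = 0
Δrow _          = 1

module _ {n : ℕ} where

  Step-along : ∀ δ {a b : V n} → col a + Δcol δ ≡ col b → row a + Δrow δ ≡ row b → Step a b
  Step-along vertical   ec er = inj₁ (trans (sym (+-identityʳ _)) ec , trans (+-comm 1 _) er)
  Step-along horizontal ec er = inj₂ (trans (+-comm 1 _) ec , inj₁ (sym (trans (sym (+-identityʳ _)) er)))
  Step-along diagonal   ec er = inj₂ (trans (+-comm 1 _) ec , inj₂ (sym (trans (+-comm 1 _) er)))

  -- the first step of a segment stays in the triangle, by convexity
  segment-next-valid : ∀ δ d (u v : V n) →
    col u + suc d * Δcol δ ≡ col v → row u + suc d * Δrow δ ≡ row v →
    col u + Δcol δ < n × row u + Δrow δ ≤ col u + Δcol δ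
  segment-next-valid δ d u v ec er =
    ≤-<-trans (≤-trans (+-monoʳ-≤ (col u) (m≤m+n (Δcol δ) _)) (≤-reflexive ec)) (col<n v) , valid δ ec er
    where
    valid : ∀ δ → col u + suc d * Δcol δ ≡ col v → row u + suc d * Δrow δ ≡ row v →
            row u + Δrow δ ≤ col u + Δcol δ
    valid vertical ec er = begin
      row u + 1            ≤⟨ +-monoʳ-≤ (row u) (m≤m+n 1 (d * 1)) ⟩
      row u + suc d * 1    ≡⟨ er ⟩
      row v                ≤⟨ row≤col v ⟩
      col v                ≡⟨ ec ⟨
      col u + suc d * 0    ≡⟨ cong (col u +_) (*-zeroʳ d) ⟩
      col u + 0            ∎
      where open ≤-Reasoning
    valid horizontal _ _ = ≤-trans (≤-reflexive (+-identityʳ (row u))) (≤-trans (row≤col u) (m≤m+n (col u) 1))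
    valid diagonal   _ _ = +-monoˡ-≤ 1 (row≤col u)

  segmentPath : (S : District n) (δ : Dir) (d : ℕ) (u v : V n) →
    col u + d * Δcol δ ≡ col v → row u + d * Δrow δ ≡ row v →
    (∀ j (w : V n) → j ≤ d → col u + j * Δcol δ ≡ col w → row u + j * Δrow δ ≡ row w → S w) →
    Path S u v
  segmentPath S δ zero u v ec er inS =
    subst (Path S u) (≡-byCoords (trans (sym (+-identityʳ _)) ec) (trans (sym (+-identityʳ _)) er)) ε
  segmentPath S δ (suc d) u v ec er inS with segment-next-valid δ d u v ec er
  ... | c<n , r≤c with vertexAt c<n r≤c
  ...   | w , ew₁ , ew₂ =
    (inj₁ (Step-along δ (sym ew₁) (sym ew₂)) , inS 0 u z≤n (+-identityʳ _) (+-identityʳ _) ,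
       inS 1 w (s≤s z≤n) (shift-once (col u) (Δcol δ) ew₁) (shift-once (row u) (Δrow δ) ew₂))
    ◅ segmentPath S δ d w v (shift-rest (col u) (Δcol δ) d ew₁ ec) (shift-rest (row u) (Δrow δ) d ew₂ er)
        (λ j w′ j≤d ec′ er′ → inS (suc j) w′ (s≤s j≤d) (shift-back (col u) (Δcol δ) j ew₁ ec′) (shift-back (row u) (Δrow δ) j ew₂ er′))
    where
    shift-once : ∀ a Δ {b} → b ≡ a + Δ → a + 1 * Δ ≡ b
    shift-once a Δ e = trans (cong (a +_) (+-identityʳ Δ)) (sym e)
    shift-rest : ∀ a Δ j {b c} → b ≡ a + Δ → a + (Δ + j * Δ) ≡ c → b + j * Δ ≡ c
    shift-rest a Δ j e e′ = trans (cong (_+ j * Δ) e) (trans (+-assoc a Δ (j * Δ)) e′)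
    shift-back : ∀ a Δ j {b c} → b ≡ a + Δ → b + j * Δ ≡ c → a + (Δ + j * Δ) ≡ c
    shift-back a Δ j e e′ = trans (sym (+-assoc a Δ (j * Δ))) (trans (cong (_+ j * Δ) (sym e)) e′)

  path-upColumn : (S : District n) (u v : V n) → col u ≡ col v → row u ≤ row v →
    (∀ w → col w ≡ col v → row u ≤ row w → row w ≤ row v → S w) → Path S v u
  path-upColumn S u v ec r≤ inS = Path-sym (segmentPath S vertical (row v ∸ row u) u v
    (trans (cong (col u +_) (*-zeroʳ (row v ∸ row u))) (trans (+-identityʳ (col u)) ec))
    (trans (cong (row u +_) (*-identityʳ (row v ∸ row u))) (m+[n∸m]≡n r≤))
    λ j w j≤d ec′ er′ → inS w (trans (sym ec′) (trans (cong (col u +_) (*-zeroʳ j)) (trans (+-identityʳ (col u)) ec)))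
      (subst (row u ≤_) (trans (cong (row u +_) (sym (*-identityʳ j))) er′) (m≤m+n (row u) j))
      (subst (_≤ row v) (trans (cong (row u +_) (sym (*-identityʳ j))) er′)
        (subst (row u + j ≤_) (m+[n∸m]≡n r≤) (+-monoʳ-≤ (row u) j≤d))))

  path-alongRow : (S : District n) (u v : V n) → row u ≡ row v → col u ≤ col v →
    (∀ w → row w ≡ row v → col u ≤ col w → col w ≤ col v → S w) → Path S v u
  path-alongRow S u v er c≤ inS = Path-sym (segmentPath S horizontal (col v ∸ col u) u v
    (trans (cong (col u +_) (*-identityʳ (col v ∸ col u))) (m+[n∸m]≡n c≤))
    (trans (cong (row u +_) (*-zeroʳ (col v ∸ col u))) (trans (+-identityʳ (row u)) er))
    λ j w j≤d ec′ er′ → inS w (trans (sym er′) (trans (cong (row u +_) (*-zeroʳ j)) (trans (+-identityʳ (row u)) er)))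
      (subst (col u ≤_) (trans (cong (col u +_) (sym (*-identityʳ j))) ec′) (m≤m+n (col u) j))
      (subst (_≤ col v) (trans (cong (col u +_) (sym (*-identityʳ j))) ec′)
        (subst (col u + j ≤_) (m+[n∸m]≡n c≤) (+-monoʳ-≤ (col u) j≤d))))

  path-alongDiagonal : (S : District n) (u v : V n) (d : ℕ) → col u + d ≡ col v → row u + d ≡ row v →
    (∀ j w → j ≤ d → col u + j ≡ col w → row u + j ≡ row w → S w) → Path S u v
  path-alongDiagonal S u v d ec er inS = segmentPath S diagonal d u v
    (trans (cong (col u +_) (*-identityʳ d)) ec) (trans (cong (row u +_) (*-identityʳ d)) er)
    λ j w j≤d ec′ er′ → inS j w j≤d (trans (cong (col u +_) (sym (*-identityʳ j))) ec′) (trans (cong (row u +_) (sym (*-identityʳ j))) er′)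

  path-viaTopRow : (S : District n) (v o : V n) → row o ≡ 0 → col o ≤ col v →
    (∀ w → col w ≡ col v → row w ≤ row v → S w) → (∀ w → row w ≡ 0 → col o ≤ col w → col w ≤ col v → S w) →
    Path S v o
  path-viaTopRow S v o ro co≤ aboveV onRow with vertexAt (col<n v) z≤n
  ... | top , ctop , rtop =
    path-upColumn S top v ctop (subst (_≤ row v) (sym rtop) z≤n) (λ w ec _ le → aboveV w ec le)
    ◅◅ path-alongRow S o top (trans ro (sym rtop)) (subst (col o ≤_) (sym ctop) co≤)
         (λ w er ge le → onRow w (trans er rtop) ge (subst (col w ≤_) ctop le))

  path-viaDiagonal : (S : District n) (v o : V n) → row o ≡ col o → col v ≤ col o →
    (∀ w → col w ≡ col v → row v ≤ row w → S w) → (∀ w → row w ≡ col w → col v ≤ col w → col w ≤ col o → S w) →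
    Path S v o
  path-viaDiagonal S v o ro cv≤ belowV onDiagonal with vertexAt (col<n v) ≤-refl
  ... | diag , cdiag , rdiag =
    Path-sym (path-upColumn S v diag (sym cdiag) (subst (row v ≤_) (sym rdiag) (row≤col v)) (λ w ec ge _ → belowV w (trans ec cdiag) ge))
    ◅◅ path-alongDiagonal S diag o (col o ∸ col v)
         (trans (cong (_+ (col o ∸ col v)) cdiag) (m+[n∸m]≡n cv≤))
         (trans (cong (_+ (col o ∸ col v)) rdiag) (trans (m+[n∸m]≡n cv≤) (sym ro)))
         λ j w j≤ ec er →
           let cw≡ = trans (cong (_+ j) (sym cdiag)) ec in
           onDiagonal w (trans (sym er) (trans (cong (_+ j) (trans rdiag (sym cdiag))) ec))
             (subst (col v ≤_) cw≡ (m≤m+n (col v) j))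
             (subst (_≤ col o) cw≡ (subst (col v + j ≤_) (m+[n∸m]≡n cv≤) (+-monoʳ-≤ (col v) j≤)))

  predecessorAlong : ∀ δ (v : V n) {c r} → c + Δcol δ ≡ col v → r + Δrow δ ≡ row v → r ≤ c →
    Σ (V n) λ w → col w ≡ c × row w ≡ r × Adj v w
  predecessorAlong δ v {c} {r} ec er r≤c with vertexAt (≤-<-trans (subst (c ≤_) ec (m≤m+n c (Δcol δ))) (col<n v)) r≤c
  ... | w , cw , rw = w , cw , rw , inj₂ (Step-along δ (trans (cong (_+ Δcol δ) cw) ec) (trans (cong (_+ Δrow δ) rw) er))

  successorAlong : ∀ δ (v : V n) {c r} → col v + Δcol δ ≡ c → row v + Δrow δ ≡ r → c < n → r ≤ c →
    Σ (V n) λ w → col w ≡ c × row w ≡ r × Adj v w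
  successorAlong δ v {c} {r} ec er c<n r≤c with vertexAt c<n r≤c
  ... | w , cw , rw = w , cw , rw , inj₁ (Step-along δ (trans ec (sym cw)) (trans er (sym rw)))

∑ : ℕ → (ℕ → ℕ) → ℕ
∑ zero    f = 0
∑ (suc k) f = f 0 + ∑ k (f ∘ suc)

∑-cong : ∀ k {f g : ℕ → ℕ} → (∀ j → j < k → f j ≡ g j) → ∑ k f ≡ ∑ k g
∑-cong zero    e = refl
∑-cong (suc k) e = cong₂ _+_ (e 0 z<s) (∑-cong k λ j j<k → e (suc j) (s<s j<k))

∑-+ : ∀ a b (f : ℕ → ℕ) → ∑ (a + b) f ≡ ∑ a f + ∑ b (λ j → f (a + j))
∑-+ zero    b f = refl
∑-+ (suc a) b f = trans (cong (f 0 +_) (∑-+ a b (f ∘ suc))) (sym (+-assoc (f 0) _ _))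

∑-split : ∀ {a k} (f : ℕ → ℕ) → a ≤ k → ∑ k f ≡ ∑ a f + ∑ (k ∸ a) (λ j → f (a + j))
∑-split {a} f a≤k = trans (cong (λ k → ∑ k f) (sym (m+[n∸m]≡n a≤k))) (∑-+ a _ f)

∑-suc : ∀ k (f : ℕ → ℕ) → ∑ (suc k) f ≡ ∑ k f + f k
∑-suc k f = begin
  ∑ (suc k) f                       ≡⟨ cong (λ l → ∑ l f) (+-comm 1 k) ⟩
  ∑ (k + 1) f                       ≡⟨ ∑-+ k 1 f ⟩
  ∑ k f + (f (k + 0) + 0)           ≡⟨ cong (λ x → ∑ k f + (f x + 0)) (+-identityʳ k) ⟩
  ∑ k f + (f k + 0)                 ≡⟨ cong (∑ k f +_) (+-identityʳ (f k)) ⟩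
  ∑ k f + f k                       ∎
  where open ≡-Reasoning

∑-zero : ∀ k → ∑ k (λ _ → 0) ≡ 0
∑-zero zero    = refl
∑-zero (suc k) = ∑-zero k

∑-one : ∀ k → ∑ k (λ _ → 1) ≡ k
∑-one zero    = refl
∑-one (suc k) = cong suc (∑-one k)

∑-distrib-+ : ∀ k (f g : ℕ → ℕ) → ∑ k (λ j → f j + g j) ≡ ∑ k f + ∑ k g
∑-distrib-+ zero    f g = refl
∑-distrib-+ (suc k) f g = begin
  (f 0 + g 0) + ∑ k (λ j → f (suc j) + g (suc j))  ≡⟨ cong (f 0 + g 0 +_) (∑-distrib-+ k (f ∘ suc) (g ∘ suc)) ⟩
  (f 0 + g 0) + (∑ k (f ∘ suc) + ∑ k (g ∘ suc))   ≡⟨ +-assoc (f 0) (g 0) _ ⟩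
  f 0 + (g 0 + (∑ k (f ∘ suc) + ∑ k (g ∘ suc)))   ≡⟨ cong (f 0 +_) (+-assoc (g 0) _ _) ⟨
  f 0 + ((g 0 + ∑ k (f ∘ suc)) + ∑ k (g ∘ suc))   ≡⟨ cong (λ x → f 0 + (x + ∑ k (g ∘ suc))) (+-comm (g 0) _) ⟩
  f 0 + ((∑ k (f ∘ suc) + g 0) + ∑ k (g ∘ suc))   ≡⟨ cong (f 0 +_) (+-assoc (∑ k (f ∘ suc)) _ _) ⟩
  f 0 + (∑ k (f ∘ suc) + (g 0 + ∑ k (g ∘ suc)))   ≡⟨ +-assoc (f 0) _ _ ⟨
  (f 0 + ∑ k (f ∘ suc)) + (g 0 + ∑ k (g ∘ suc))   ∎
  where open ≡-Reasoning

∑-suc≡tri : ∀ k → ∑ k suc ≡ tri k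
∑-suc≡tri zero    = refl
∑-suc≡tri (suc k) = trans (∑-suc k suc) (cong (_+ suc k) (∑-suc≡tri k))

∑-countBelow : ∀ K L a → ∑ L (λ r → bit (a + r <ᵇ K)) ≡ L ⊓ (K ∸ a)
∑-countBelow K zero    a = refl
∑-countBelow K (suc L) a = begin
  bit (a + 0 <ᵇ K) + ∑ L (λ r → bit (a + suc r <ᵇ K))  ≡⟨ cong₂ (λ x y → bit (x <ᵇ K) + y) (+-identityʳ a)
                                                            (∑-cong L λ r _ → cong (λ x → bit (x <ᵇ K)) (+-suc a r)) ⟩
  bit (a <ᵇ K) + ∑ L (λ r → bit (suc a + r <ᵇ K))      ≡⟨ cong (bit (a <ᵇ K) +_) (∑-countBelow K L (suc a)) ⟩
  bit (a <ᵇ K) + L ⊓ (K ∸ suc a)                       ≡⟨ step (a <? K) ⟩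
  suc L ⊓ (K ∸ a)                                      ∎
  where
  open ≡-Reasoning
  step : Dec (a < K) → bit (a <ᵇ K) + L ⊓ (K ∸ suc a) ≡ suc L ⊓ (K ∸ a)
  step (yes a<K) rewrite <⇒<ᵇ-true {a} {K} a<K = cong (suc L ⊓_) (sym (+-∸-assoc 1 a<K))
  step (no a≮K) rewrite ≥⇒<ᵇ-false {a} {K} (≮⇒≥ a≮K) =
    trans (cong (L ⊓_) (m≤n⇒m∸n≡0 (≤-trans (≮⇒≥ a≮K) (n≤1+n a))))
      (trans (⊓-zeroʳ L) (sym (trans (cong (suc L ⊓_) (m≤n⇒m∸n≡0 (≮⇒≥ a≮K))) (⊓-zeroʳ (suc L)))))

∑-ranksBelow : ∀ K k → ∑ k (λ c → ∑ (suc c) (λ r → bit (tri c + r <ᵇ K))) ≡ K ⊓ tri k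
∑-ranksBelow K zero    = sym (⊓-zeroʳ K)
∑-ranksBelow K (suc k) = begin
  ∑ (suc k) (λ c → ∑ (suc c) (λ r → bit (tri c + r <ᵇ K)))  ≡⟨ ∑-suc k (λ c → ∑ (suc c) (λ r → bit (tri c + r <ᵇ K))) ⟩
  ∑ k (λ c → ∑ (suc c) (λ r → bit (tri c + r <ᵇ K))) + ∑ (suc k) (λ r → bit (tri k + r <ᵇ K))
                                                            ≡⟨ cong₂ _+_ (∑-ranksBelow K k) (∑-countBelow K (suc k) (tri k)) ⟩
  K ⊓ tri k + suc k ⊓ (K ∸ tri k)                           ≡⟨ step (tri k ≤? K) ⟩
  K ⊓ (tri k + suc k)                                       ∎
  where
  open ≡-Reasoning
  step : Dec (tri k ≤ K) → K ⊓ tri k + suc k ⊓ (K ∸ tri k) ≡ K ⊓ (tri k + suc k)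
  step (yes le) = begin
    K ⊓ tri k + suc k ⊓ (K ∸ tri k)       ≡⟨ cong (_+ suc k ⊓ (K ∸ tri k)) (m≥n⇒m⊓n≡n le) ⟩
    tri k + suc k ⊓ (K ∸ tri k)           ≡⟨ +-distribˡ-⊓ (tri k) (suc k) (K ∸ tri k) ⟩
    (tri k + suc k) ⊓ (tri k + (K ∸ tri k)) ≡⟨ cong ((tri k + suc k) ⊓_) (m+[n∸m]≡n le) ⟩
    (tri k + suc k) ⊓ K                   ≡⟨ ⊓-comm _ K ⟩
    K ⊓ (tri k + suc k)                   ∎
  step (no ≰) = begin
    K ⊓ tri k + suc k ⊓ (K ∸ tri k)       ≡⟨ cong₂ _+_ (m≤n⇒m⊓n≡m K≤) (cong (suc k ⊓_) (m≤n⇒m∸n≡0 K≤)) ⟩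
    K + suc k ⊓ 0                         ≡⟨ cong (K +_) (⊓-zeroʳ (suc k)) ⟩
    K + 0                                 ≡⟨ +-identityʳ K ⟩
    K                                     ≡⟨ m≤n⇒m⊓n≡m (≤-trans K≤ (m≤m+n (tri k) (suc k))) ⟨
    K ⊓ (tri k + suc k)                   ∎
    where K≤ = <⇒≤ (≰⇒> ≰)

∑-below : ∀ {u L} (f : ℕ → ℕ) → u ≤ L → ∑ L (λ r → if r <ᵇ u then f r else 0) ≡ ∑ u f
∑-below {u} {L} f u≤L = begin
  ∑ L h                                              ≡⟨ ∑-split h u≤L ⟩
  ∑ u h + ∑ (L ∸ u) (λ j → h (u + j))                ≡⟨ cong₂ _+_ (∑-cong u λ r r<u → cong (λ b → if b then f r else 0) (<⇒<ᵇ-true r<u))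
                                                                   (∑-cong (L ∸ u) λ j _ →
                                                                      cong (λ b → if b then f (u + j) else 0) (≥⇒<ᵇ-false (m≤m+n u j))) ⟩
  ∑ u f + ∑ (L ∸ u) (λ _ → 0)                        ≡⟨ cong (∑ u f +_) (∑-zero (L ∸ u)) ⟩
  ∑ u f + 0                                          ≡⟨ +-identityʳ _ ⟩
  ∑ u f                                              ∎
  where
  open ≡-Reasoning
  h : ℕ → ℕ
  h r = if r <ᵇ u then f r else 0

∑-from : ∀ {u L} (f : ℕ → ℕ) → u ≤ L → ∑ L (λ r → if r <ᵇ u then 0 else f r) ≡ ∑ (L ∸ u) (λ j → f (u + j))
∑-from {u} {L} f u≤L = begin
  ∑ L h                                              ≡⟨ ∑-split h u≤L ⟩
  ∑ u h + ∑ (L ∸ u) (λ j → h (u + j))                ≡⟨ cong₂ _+_ (∑-cong u λ r r<u → cong (λ b → if b then 0 else f r) (<⇒<ᵇ-true r<u))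
                                                                   (∑-cong (L ∸ u) λ j _ →
                                                                      cong (λ b → if b then 0 else f (u + j)) (≥⇒<ᵇ-false (m≤m+n u j))) ⟩
  ∑ u (λ _ → 0) + ∑ (L ∸ u) (λ j → f (u + j))        ≡⟨ cong (_+ ∑ (L ∸ u) (λ j → f (u + j))) (∑-zero u) ⟩
  ∑ (L ∸ u) (λ j → f (u + j))                        ∎
  where
  open ≡-Reasoning
  h : ℕ → ℕ
  h r = if r <ᵇ u then 0 else f r

∑-bit-<ᵇ : ∀ {a L} → a ≤ L → ∑ L (λ r → bit (r <ᵇ a)) ≡ a
∑-bit-<ᵇ {a} a≤L = trans (∑-below (λ _ → 1) a≤L) (∑-one a)

∑-bit≤ : ∀ L (f : ℕ → Bool) → ∑ L (λ r → bit (f r)) ≤ L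
∑-bit≤ zero    f = z≤n
∑-bit≤ (suc L) f with f 0
... | true  = s≤s (∑-bit≤ L (λ r → f (suc r)))
... | false = m≤n⇒m≤1+n (∑-bit≤ L (λ r → f (suc r)))

∑-bit+∑-bit-not : ∀ L (f : ℕ → Bool) → ∑ L (λ r → bit (f r)) + ∑ L (λ r → bit (not (f r))) ≡ L
∑-bit+∑-bit-not L f = trans (sym (∑-distrib-+ L _ _)) (trans (∑-cong L λ r _ → bit+bit-not (f r)) (∑-one L))
  where bit+bit-not : ∀ b → bit b + bit (not b) ≡ 1
        bit+bit-not true  = refl
        bit+bit-not false = refl

isLabel : Fin 3 → Fin 3 → ℕ
isLabel j a = bit (does (a ≟F j))

isLabel-total : ∀ a → isLabel L₁ a + isLabel L₂ a + isLabel L₃ a ≡ 1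
isLabel-total L₁ = refl
isLabel-total L₂ = refl
isLabel-total L₃ = refl

module _ {A : Set} {P : A → Set} (P? : ∀ x → Dec (P x)) where

  length-filter-map-allFin : ∀ k (f : Fin k → A) (g : ℕ → ℕ) → (∀ i → bit (does (P? (f i))) ≡ g (toℕ i)) →
    length (filter P? (map f (allFin k))) ≡ ∑ k g
  length-filter-map-allFin zero    f g e = refl
  length-filter-map-allFin (suc k) f g e
    rewrite map-tabulate {n = k} fsuc f | sym (map-tabulate {n = k} id (f ∘ fsuc))
    with does (P? (f zero)) | e zero
  ... | true  | e₀ = trans (cong suc (length-filter-map-allFin k (f ∘ fsuc) (g ∘ suc) (e ∘ fsuc))) (cong (_+ ∑ k (g ∘ suc)) e₀)
  ... | false | e₀ = trans (length-filter-map-allFin k (f ∘ fsuc) (g ∘ suc) (e ∘ fsuc)) (cong (_+ ∑ k (g ∘ suc)) e₀)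

  length-filter-concatMap-allFin : ∀ k (F : Fin k → List A) (g : ℕ → ℕ) → (∀ i → length (filter P? (F i)) ≡ g (toℕ i)) →
    length (filter P? (concatMap F (allFin k))) ≡ ∑ k g
  length-filter-concatMap-allFin zero    F g e = refl
  length-filter-concatMap-allFin (suc k) F g e
    rewrite map-tabulate {n = k} fsuc F | sym (map-tabulate {n = k} id (F ∘ fsuc))
          | filter-++ P? (F zero) (concatMap (F ∘ fsuc) (allFin k))
          | length-++ (filter P? (F zero)) {filter P? (concatMap (F ∘ fsuc) (allFin k))} =
    cong₂ _+_ (e zero) (length-filter-concatMap-allFin k (F ∘ fsuc) (g ∘ suc) (e ∘ fsuc))

module _ {n : ℕ} where

  size-byCoords : (Q : Labelling n) (h : ℕ → ℕ → Fin 3) → (∀ v → Q v ≡ h (col v) (row v)) →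
    ∀ j → size Q j ≡ ∑ n (λ c → ∑ (suc c) (λ r → isLabel j (h c r)))
  size-byCoords Q h Q≡h j =
    length-filter-concatMap-allFin (λ v → Q v ≟F j) n _ (λ c → ∑ (suc c) (λ r → isLabel j (h c r))) λ c →
      length-filter-map-allFin (λ v → Q v ≟F j) (suc (toℕ c)) (c ,_) (λ r → isLabel j (h (toℕ c) r)) λ r →
        cong (isLabel j) (Q≡h (c , r))

  size-total : (Q : Labelling n) (h : ℕ → ℕ → Fin 3) → (∀ v → Q v ≡ h (col v) (row v)) →
    size Q L₁ + size Q L₂ + size Q L₃ ≡ tri n
  size-total Q h Q≡h = begin
    size Q L₁ + size Q L₂ + size Q L₃
      ≡⟨ cong₂ _+_ (cong₂ _+_ (size-byCoords Q h Q≡h L₁) (size-byCoords Q h Q≡h L₂)) (size-byCoords Q h Q≡h L₃) ⟩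
    ∑ n (count L₁) + ∑ n (count L₂) + ∑ n (count L₃)
      ≡⟨ ∑-distrib₃ n (count L₁) (count L₂) (count L₃) ⟨
    ∑ n (λ c → count L₁ c + count L₂ c + count L₃ c)
      ≡⟨ ∑-cong n (λ c _ → trans (sym (∑-distrib₃ (suc c) (isLabelAt L₁ c) (isLabelAt L₂ c) (isLabelAt L₃ c)))
                                  (∑-cong (suc c) λ r _ → isLabel-total (h c r))) ⟩
    ∑ n (λ c → ∑ (suc c) (λ _ → 1))
      ≡⟨ ∑-cong n (λ c _ → ∑-one (suc c)) ⟩
    ∑ n suc
      ≡⟨ ∑-suc≡tri n ⟩
    tri n ∎
    where
    open ≡-Reasoning
    isLabelAt : Fin 3 → ℕ → ℕ → ℕ
    isLabelAt j c r = isLabel j (h c r)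
    count : Fin 3 → ℕ → ℕ
    count j c = ∑ (suc c) (isLabelAt j c)
    ∑-distrib₃ : ∀ k (f g h : ℕ → ℕ) → ∑ k (λ j → f j + g j + h j) ≡ ∑ k f + ∑ k g + ∑ k h
    ∑-distrib₃ k f g h = trans (∑-distrib-+ k (λ j → f j + g j) h) (cong (_+ ∑ k h) (∑-distrib-+ k f g))

module _ {n : ℕ} where

  size-agree : (A B : Labelling n) (j : Fin 3) → AgreeOn A B j → size A j ≡ size B j
  size-agree A B j agree = go (allV n)
    where
    go : (vs : List (V n)) → length (filter (λ v → A v ≟F j) vs) ≡ length (filter (λ v → B v ≟F j) vs)
    go []       = refl
    go (v ∷ vs) with A v ≟F j | B v ≟F j
    ... | yes _  | yes _  = cong suc (go vs)
    ... | no  _  | no  _  = go vs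
    ... | yes Av | no ¬Bv = ⊥-elim (¬Bv (proj₁ (agree v) Av))
    ... | no ¬Av | yes Bv = ⊥-elim (¬Av (proj₂ (agree v) Bv))

  size-mono : (A B : Labelling n) {i j : Fin 3} → (∀ v → A v ≡ i → B v ≡ j) → size A i ≤ size B j
  size-mono A B {i} {j} A⇒B = go (allV n)
    where
    go : (vs : List (V n)) → length (filter (λ v → A v ≟F i) vs) ≤ length (filter (λ v → B v ≟F j) vs)
    go []       = z≤n
    go (v ∷ vs) with A v ≟F i | B v ≟F j
    ... | yes _  | yes _  = s≤s (go vs)
    ... | no  _  | yes _  = m≤n⇒m≤1+n (go vs)
    ... | no  _  | no  _  = go vs
    ... | yes Av | no ¬Bv = ⊥-elim (¬Bv (A⇒B v Av))

  -- the first column consists of the single corner vertex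
  ¬district₁⊆firstColumn : (P : Labelling n) → 2 ≤ size P L₁ → ¬ (∀ v → P v ≡ L₁ → col v ≡ 0)
  ¬district₁⊆firstColumn P 2≤size inFirst = <⇒≱ 2≤size (
    ≤-trans (size-mono P firstColumn (λ v Pv → cong (λ c → label c (row v)) (inFirst v Pv)))
            (≤-trans (≤-reflexive (size-byCoords firstColumn label (λ _ → refl) L₁)) (count n)))
    where
    label : ℕ → ℕ → Fin 3
    label zero    _ = L₁
    label (suc _) _ = L₂
    firstColumn : Labelling n
    firstColumn v = label (col v) (row v)
    count : ∀ n → ∑ n (λ c → ∑ (suc c) (λ r → isLabel L₁ (label c r))) ≤ 1
    count zero    = z≤n
    count (suc n) = ≤-reflexive (cong suc (trans (∑-cong n λ c _ → ∑-zero (suc (suc c))) (∑-zero n)))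

-- Simple connectivity by counting crossings of a horizontal ray

tally : {A : Set} → (A → Bool) → List A → ℕ
tally p []       = 0
tally p (x ∷ xs) = bit (p x) + tally p xs

tally-≡0 : {A : Set} (p : A → Bool) {xs : List A} → All (λ x → p x ≡ false) xs → tally p xs ≡ 0
tally-≡0 p []         = refl
tally-≡0 p (px ∷ pxs) rewrite px = tally-≡0 p pxs

tally-+ : {A : Set} (p q r : A → Bool) → (∀ x → bit (p x) + bit (q x) ≡ bit (r x)) →
  ∀ xs → tally p xs + tally q xs ≡ tally r xs
tally-+ p q r e []       = refl
tally-+ p q r e (x ∷ xs) = begin
  (bit (p x) + tally p xs) + (bit (q x) + tally q xs)  ≡⟨ +-assoc (bit (p x)) _ _ ⟩
  bit (p x) + (tally p xs + (bit (q x) + tally q xs))  ≡⟨ cong (bit (p x) +_) (+-assoc (tally p xs) _ _) ⟨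
  bit (p x) + ((tally p xs + bit (q x)) + tally q xs)  ≡⟨ cong (λ y → bit (p x) + (y + tally q xs)) (+-comm (tally p xs) _) ⟩
  bit (p x) + ((bit (q x) + tally p xs) + tally q xs)  ≡⟨ cong (bit (p x) +_) (+-assoc (bit (q x)) _ _) ⟩
  bit (p x) + (bit (q x) + (tally p xs + tally q xs))  ≡⟨ +-assoc (bit (p x)) _ _ ⟨
  (bit (p x) + bit (q x)) + (tally p xs + tally q xs)  ≡⟨ cong₂ _+_ (e x) (tally-+ p q r e xs) ⟩
  bit (r x) + tally r xs                               ∎
  where open ≡-Reasoning

⟦_⟧ : Bool → Parity
⟦ b ⟧ = parity (bit b)

⟦xor⟧ : ∀ x y → ⟦ x xor y ⟧ ≡ ⟦ x ⟧ ⊕ ⟦ y ⟧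
⟦xor⟧ false false = refl
⟦xor⟧ false true  = refl
⟦xor⟧ true  false = refl
⟦xor⟧ true  true  = refl

module _ {A : Set} (f : A → Bool) where

  switches : A × A → Bool
  switches (a , b) = f a xor f b

  parity-switches-walk : ∀ a xs z → parity (tally switches (zip (a ∷ xs) (xs ++ [ z ]))) ≡ ⟦ f a ⟧ ⊕ ⟦ f z ⟧
  parity-switches-walk a [] z = begin
    parity (bit (f a xor f z) + 0)  ≡⟨ +-homo-+ (bit (f a xor f z)) 0 ⟩
    ⟦ f a xor f z ⟧ ⊕ 0ℙ                     ≡⟨ ⊕-identityʳ _ ⟩
    ⟦ f a xor f z ⟧                          ≡⟨ ⟦xor⟧ (f a) (f z) ⟩
    ⟦ f a ⟧ ⊕ ⟦ f z ⟧                        ∎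
    where open ≡-Reasoning
  parity-switches-walk a (y ∷ ys) z = begin
    parity (bit (f a xor f y) + rest)   ≡⟨ +-homo-+ (bit (f a xor f y)) rest ⟩
    ⟦ f a xor f y ⟧ ⊕ parity rest       ≡⟨ cong₂ _⊕_ (⟦xor⟧ (f a) (f y)) (parity-switches-walk y ys z) ⟩
    (⟦ f a ⟧ ⊕ ⟦ f y ⟧) ⊕ (⟦ f y ⟧ ⊕ ⟦ f z ⟧)   ≡⟨ ⊕-assoc ⟦ f a ⟧ _ _ ⟩
    ⟦ f a ⟧ ⊕ (⟦ f y ⟧ ⊕ (⟦ f y ⟧ ⊕ ⟦ f z ⟧))   ≡⟨ cong (⟦ f a ⟧ ⊕_) (⊕-assoc ⟦ f y ⟧ _ _) ⟨
    ⟦ f a ⟧ ⊕ ((⟦ f y ⟧ ⊕ ⟦ f y ⟧) ⊕ ⟦ f z ⟧)   ≡⟨ cong (λ p → ⟦ f a ⟧ ⊕ (p ⊕ ⟦ f z ⟧)) (⊕-self ⟦ f y ⟧) ⟩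
    ⟦ f a ⟧ ⊕ ⟦ f z ⟧                           ∎
    where
    open ≡-Reasoning
    rest = tally switches (zip (y ∷ ys) (ys ++ [ z ]))

parity-switches-closedWalk : ∀ {n} (f : V n → Bool) xs → parity (tally (switches f) (cycEdges xs)) ≡ 0ℙ
parity-switches-closedWalk f []       = refl
parity-switches-closedWalk f (x ∷ xs) = trans (parity-switches-walk f x xs x) (⊕-self ⟦ f x ⟧)

-- The vertex (c , r) lies at height (c − 2r)/2 (compare lowerEq); inequalities between heights below
-- are stated with both sides shifted so that no subtraction occurs.
data Neighbour : ℕ → ℕ → ℕ → ℕ → Set where
  down      : ∀ {c r} → Neighbour c r c (suc r)
  right     : ∀ {c r} → Neighbour c r (suc c) r
  downRight : ∀ {c r} → Neighbour c r (suc c) (suc r)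
  up        : ∀ {c r} → Neighbour c (suc r) c r
  left      : ∀ {c r} → Neighbour (suc c) r c r
  upLeft    : ∀ {c r} → Neighbour (suc c) (suc r) c r

Adj⇒Neighbour : ∀ {n} {a b : V n} → Adj a b → Neighbour (col a) (row a) (col b) (row b)
Adj⇒Neighbour {a = a} (inj₁ (inj₁ (e₁ , e₂)))        = subst₂ (Neighbour (col a) (row a)) e₁ e₂ down
Adj⇒Neighbour {a = a} (inj₁ (inj₂ (e₁ , inj₁ e₂)))   = subst₂ (Neighbour (col a) (row a)) e₁ (sym e₂) right
Adj⇒Neighbour {a = a} (inj₁ (inj₂ (e₁ , inj₂ e₂)))   = subst₂ (Neighbour (col a) (row a)) e₁ (sym e₂) downRight
Adj⇒Neighbour {b = b} (inj₂ (inj₁ (e₁ , e₂)))        = subst₂ (λ c r → Neighbour c r (col b) (row b)) e₁ e₂ up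
Adj⇒Neighbour {b = b} (inj₂ (inj₂ (e₁ , inj₁ e₂)))   = subst₂ (λ c r → Neighbour c r (col b) (row b)) e₁ (sym e₂) left
Adj⇒Neighbour {b = b} (inj₂ (inj₂ (e₁ , inj₂ e₂)))   = subst₂ (λ c r → Neighbour c r (col b) (row b)) e₁ (sym e₂) upLeft

≤-byOffset : ∀ {x y} k → x + k ≡ y → x ≤ y
≤-byOffset {x} k e = subst (x ≤_) e (m≤m+n x k)

≰-byOffset : ∀ {x y} k → y + suc k ≡ x → ¬ (x ≤ y)
≰-byOffset {y = y} k e x≤y = m+1+n≰m y (subst (_≤ y) (sym e) x≤y)

neighbour-rise≤2 : ∀ {cl rl ch rh} → Neighbour cl rl ch rh → ch + 2 * rl ≤ cl + 2 * rh + 2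
neighbour-rise≤2 (down {c} {r}) = ≤-byOffset 4 (e c r)
  where e : ∀ c r → c + 2 * r + 4 ≡ c + 2 * suc r + 2
        e = solve-∀
neighbour-rise≤2 (right {c} {r}) = ≤-byOffset 1 (e c r)
  where e : ∀ c r → suc c + 2 * r + 1 ≡ c + 2 * r + 2
        e = solve-∀
neighbour-rise≤2 (downRight {c} {r}) = ≤-byOffset 3 (e c r)
  where e : ∀ c r → suc c + 2 * r + 3 ≡ c + 2 * suc r + 2
        e = solve-∀
neighbour-rise≤2 (up {c} {r}) = ≤-byOffset 0 (e c r)
  where e : ∀ c r → c + 2 * suc r + 0 ≡ c + 2 * r + 2
        e = solve-∀
neighbour-rise≤2 (left {c} {r}) = ≤-byOffset 3 (e c r)
  where e : ∀ c r → c + 2 * r + 3 ≡ suc c + 2 * r + 2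
        e = solve-∀
neighbour-rise≤2 (upLeft {c} {r}) = ≤-byOffset 1 (e c r)
  where e : ∀ c r → c + 2 * suc r + 1 ≡ suc c + 2 * r + 2
        e = solve-∀

neighbour-rise≥2⇒up : ∀ {cl rl ch rh} → Neighbour cl rl ch rh → cl + 2 * rh + 2 ≤ ch + 2 * rl → ch ≡ cl × rl ≡ suc rh
neighbour-rise≥2⇒up (down {c} {r}) h = ⊥-elim (≰-byOffset 3 (e c r) h)
  where e : ∀ c r → c + 2 * r + 4 ≡ c + 2 * suc r + 2
        e = solve-∀
neighbour-rise≥2⇒up (right {c} {r}) h = ⊥-elim (≰-byOffset 0 (e c r) h)
  where e : ∀ c r → suc c + 2 * r + 1 ≡ c + 2 * r + 2
        e = solve-∀
neighbour-rise≥2⇒up (downRight {c} {r}) h = ⊥-elim (≰-byOffset 2 (e c r) h)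
  where e : ∀ c r → suc c + 2 * r + 3 ≡ c + 2 * suc r + 2
        e = solve-∀
neighbour-rise≥2⇒up up h = refl , refl
neighbour-rise≥2⇒up (left {c} {r}) h = ⊥-elim (≰-byOffset 2 (e c r) h)
  where e : ∀ c r → c + 2 * r + 3 ≡ suc c + 2 * r + 2
        e = solve-∀
neighbour-rise≥2⇒up (upLeft {c} {r}) h = ⊥-elim (≰-byOffset 0 (e c r) h)
  where e : ∀ c r → c + 2 * suc r + 1 ≡ suc c + 2 * r + 2
        e = solve-∀

half-≤ : ∀ {a b} → 2 * a ≤ suc (2 * b) → a ≤ b
half-≤ {a} {b} h with a ≤? b
... | yes a≤b = a≤b
... | no  a≰b = ⊥-elim (<⇒≱ (<-≤-trans (n<1+n (suc (2 * b))) (subst (_≤ 2 * a) (*-suc 2 b) (*-monoʳ-≤ 2 (≰⇒> a≰b)))) h)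

leftRay-crossing : ∀ {cl rl ch rh cw rw} → Neighbour cl rl ch rh →
  cl + 2 * rw ≤ cw + 2 * rl → ¬ (ch + 2 * rw ≤ cw + 2 * rh) →
  cl ≤ cw → cw ≤ suc cl → ¬ (cl ≡ cw × rl ≡ rw) →
  suc ch ≡ cw × suc rh ≡ rw
leftRay-crossing {cl} {rl} {ch} {rh} {cw} {rw} nb below above cl≤cw cw≤1+cl l≢w with m≤n⇒m<n∨m≡n cl≤cw
... | inj₂ refl = ⊥-elim (above (+-cancelʳ-≤ 2 _ _ (begin
    ch + 2 * rw + 2    ≡⟨ e ch rw ⟩
    ch + 2 * suc rw    ≤⟨ +-monoʳ-≤ ch (*-monoʳ-≤ 2 rw<rl) ⟩
    ch + 2 * rl        ≤⟨ neighbour-rise≤2 nb ⟩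
    cl + 2 * rh + 2    ∎)))
  where
  open ≤-Reasoning
  rw<rl : rw < rl
  rw<rl = ≤∧≢⇒< (*-cancelˡ-≤ 2 (+-cancelˡ-≤ cl _ _ below)) (λ e → l≢w (refl , sym e))
  e : ∀ c r → c + 2 * r + 2 ≡ c + 2 * suc r
  e = solve-∀
... | inj₁ cl<cw with ≤-antisym cl<cw cw≤1+cl
...   | refl = cong suc ch≡cl , ≤-antisym (*-cancelˡ-≤ 2 h≺w) (subst (rw ≤_) rl≡1+rh rw≤rl)
  where
  open ≤-Reasoning
  e : ∀ c r → suc (suc c + 2 * r) ≡ c + 2 * r + 2
  e = solve-∀
  e′ : ∀ c r → suc (suc c + 2 * r) ≡ c + 2 * suc r
  e′ = solve-∀
  rw≤rl : rw ≤ rl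
  rw≤rl = half-≤ (+-cancelˡ-≤ cl _ _ (subst (cl + 2 * rw ≤_) (sym (+-suc cl (2 * rl))) below))
  rise : cl + 2 * rh + 2 ≤ ch + 2 * rl
  rise = begin
    cl + 2 * rh + 2       ≡⟨ e cl rh ⟨
    suc (suc cl + 2 * rh) ≤⟨ ≰⇒> above ⟩
    ch + 2 * rw           ≤⟨ +-monoʳ-≤ ch (*-monoʳ-≤ 2 rw≤rl) ⟩
    ch + 2 * rl           ∎
  ch≡cl : ch ≡ cl
  ch≡cl = proj₁ (neighbour-rise≥2⇒up nb rise)
  rl≡1+rh : rl ≡ suc rh
  rl≡1+rh = proj₂ (neighbour-rise≥2⇒up nb rise)
  h≺w : 2 * suc rh ≤ 2 * rw
  h≺w = +-cancelˡ-≤ cl _ _ (begin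
    cl + 2 * suc rh        ≡⟨ e′ cl rh ⟨
    suc (suc cl + 2 * rh)  ≤⟨ ≰⇒> above ⟩
    ch + 2 * rw            ≡⟨ cong (_+ 2 * rw) ch≡cl ⟩
    cl + 2 * rw            ∎)

crossings-split : ∀ la lb ca cb →
  bit ((la ∧ not lb ∧ ca) ∨ (lb ∧ not la ∧ cb)) + bit ((la ∧ not lb ∧ not ca) ∨ (lb ∧ not la ∧ not cb)) ≡ bit (la xor lb)
crossings-split false false ca    cb    = refl
crossings-split false true  ca    false = refl
crossings-split false true  ca    true  = refl
crossings-split true  false false cb    = refl
crossings-split true  false true  cb    = refl
crossings-split true  true  ca    cb    = refl

%2≡1⇒parity≡1ℙ : ∀ k → k % 2 ≡ 1 → parity k ≡ 1ℙ
%2≡1⇒parity≡1ℙ 1             _ = refl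
%2≡1⇒parity≡1ℙ (suc (suc k)) e = %2≡1⇒parity≡1ℙ k (trans (sym ([m+n]%n≡m%n k 2)) (trans (cong (_% 2) (+-comm k 2)) e))

All-zip : {A : Set} {Q : A → Set} {xs ys : List A} → All Q xs → All Q ys → All (λ e → Q (proj₁ e) × Q (proj₂ e)) (zip xs ys)
All-zip []         _          = []
All-zip (_ ∷ _)    []         = []
All-zip (p ∷ ps)   (q ∷ qs)   = (p , q) ∷ All-zip ps qs

module _ {n : ℕ} where

  All-cycEdges : {Q : V n → Set} {vs : List (V n)} → All Q vs → All (λ e → Q (proj₁ e) × Q (proj₂ e)) (cycEdges vs)
  All-cycEdges []         = []
  All-cycEdges (p ∷ ps)   = All-zip (p ∷ ps) (++⁺ ps (p ∷ []))

  crossesLeft : V n → V n → V n → Bool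
  crossesLeft w a b =
      (lowerEq a w ∧ not (lowerEq b w) ∧ not (col w <ᵇ col a))
    ∨ (lowerEq b w ∧ not (lowerEq a w) ∧ not (col w <ᵇ col b))

  crossCount≡tally : (w : V n) (es : List (V n × V n)) → crossCount w es ≡ tally (λ e → crosses w (proj₁ e) (proj₂ e)) es
  crossCount≡tally w []             = refl
  crossCount≡tally w ((a , b) ∷ es) = cong (bit (crosses w a b) +_) (crossCount≡tally w es)

  ¬encloses-withoutRightCrossing : (vs : List (V n)) (w : V n) → crossCount w (cycEdges vs) ≡ 0 → ¬ Encloses vs w
  ¬encloses-withoutRightCrossing vs w none enc = 0ℙ≢1ℙ (trans (cong parity (sym none)) (%2≡1⇒parity≡1ℙ (crossCount w (cycEdges vs)) enc))
    where 0ℙ≢1ℙ : 0ℙ ≢ 1ℙ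
          0ℙ≢1ℙ ()

  -- the horizontal line through w is crossed an even number of times, so with no crossing on the left
  -- the number of crossings on the right is even
  ¬encloses-withoutLeftCrossing : (vs : List (V n)) (w : V n) → tally (λ e → crossesLeft w (proj₁ e) (proj₂ e)) (cycEdges vs) ≡ 0 → ¬ Encloses vs w
  ¬encloses-withoutLeftCrossing vs w none enc = 1ℙ≢0ℙ (begin
    1ℙ                                        ≡⟨ %2≡1⇒parity≡1ℙ (crossCount w es) enc ⟨
    parity (crossCount w es)                  ≡⟨ cong parity (crossCount≡tally w es) ⟩
    parity (tally onRight es)                   ≡⟨ cong parity (+-identityʳ (tally onRight es)) ⟨
    parity (tally onRight es + 0)               ≡⟨ cong (λ k → parity (tally onRight es + k)) none ⟨
    parity (tally onRight es + tally onLeft es)   ≡⟨ cong parity (tally-+ onRight onLeft (switches (λ a → lowerEq a w)) split es) ⟩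
    parity (tally (switches (λ a → lowerEq a w)) es) ≡⟨ parity-switches-closedWalk (λ a → lowerEq a w) vs ⟩
    0ℙ                                        ∎)
    where
    open ≡-Reasoning
    1ℙ≢0ℙ : 1ℙ ≢ 0ℙ
    1ℙ≢0ℙ ()
    es : List (V n × V n)
    es = cycEdges vs
    onRight onLeft : V n × V n → Bool
    onRight e = crosses w (proj₁ e) (proj₂ e)
    onLeft e = crossesLeft w (proj₁ e) (proj₂ e)
    split : ∀ e → bit (onRight e) + bit (onLeft e) ≡ bit (switches (λ a → lowerEq a w) e)
    split (a , b) = crossings-split (lowerEq a w) (lowerEq b w) (col w <ᵇ col a) (col w <ᵇ col b)

  -- sufficient conditions on S for no edge inside S to cross the ray from w to the right, resp. to the left
  RightRayFree : District n → V n → Set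
  RightRayFree S w = ∀ v → S v → col v ≤ col w

  LeftRayFree : District n → V n → Set
  LeftRayFree S w = (∀ v → S v → col w ≤ suc (col v)) × (∀ h → S h → ¬ (suc (col h) ≡ col w × suc (row h) ≡ row w))

  noRightCrossing : (S : District n) {w a b : V n} → RightRayFree S w → S a → S b → crosses w a b ≡ false
  noRightCrossing S {w} {a} {b} free Sa Sb
    rewrite ≥⇒<ᵇ-false {col w} {col a} (free a Sa) | ≥⇒<ᵇ-false {col w} {col b} (free b Sb) = lemma (lowerEq a w) (lowerEq b w)
    where
    lemma : ∀ x y → (x ∧ not y ∧ false) ∨ (y ∧ not x ∧ false) ≡ false
    lemma false false = refl
    lemma false true  = refl
    lemma true  false = refl
    lemma true  true  = refl

  leftCrossing-impossible : (S : District n) {w l h : V n} → ¬ S w → LeftRayFree S w → S l → S h → Adj l h →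
    lowerEq l w ≡ true → lowerEq h w ≡ false → (col w <ᵇ col l) ≡ false → ⊥
  leftCrossing-impossible S {w} {l} {h} ¬Sw free Sl Sh adj el eh cl =
    proj₂ free h Sh (leftRay-crossing (Adj⇒Neighbour adj) (≤ᵇ-true⇒≤ el) (≤ᵇ-false⇒≰ eh) (<ᵇ-false⇒≥ cl) (proj₁ free l Sl)
                       λ (e₁ , e₂) → ¬Sw (subst S (≡-byCoords e₁ e₂) Sl))

  noLeftCrossing : (S : District n) {w a b : V n} → ¬ S w → LeftRayFree S w → S a → S b → Adj a b → crossesLeft w a b ≡ false
  noLeftCrossing S {w} {a} {b} ¬Sw free Sa Sb adj
    with lowerEq a w in ea | lowerEq b w in eb | col w <ᵇ col a in ca | col w <ᵇ col b in cb
  ... | false | false | _     | _     = refl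
  ... | true  | true  | _     | _     = refl
  ... | true  | false | true  | _     = refl
  ... | true  | false | false | _     = ⊥-elim (leftCrossing-impossible S ¬Sw free Sa Sb adj ea eb ca)
  ... | false | true  | _     | true  = refl
  ... | false | true  | _     | false = ⊥-elim (leftCrossing-impossible S ¬Sw free Sb Sa (Adj-sym adj) eb ea cb)

  simplyConnected-byRays : (S : District n) → (∀ v → Dec (S v)) →
    (∀ w → ¬ S w → RightRayFree S w ⊎ LeftRayFree S w) → SimplyConnected S
  simplyConnected-byRays S S? free vs (_ , _ , adjs) inS w enc with S? w
  ... | yes Sw = Sw
  ... | no ¬Sw with free w ¬Sw
  ...   | inj₁ rightFree = ⊥-elim (¬encloses-withoutRightCrossing vs w
            (trans (crossCount≡tally w (cycEdges vs))
              (tally-≡0 _ (All.map (λ (Sa , Sb) → noRightCrossing S {w} rightFree Sa Sb) (All-cycEdges inS)))) enc)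
  ...   | inj₂ leftFree = ⊥-elim (¬encloses-withoutLeftCrossing vs w
            (tally-≡0 _ (All.zipWith (λ (adj , Sa , Sb) → noLeftCrossing S ¬Sw leftFree Sa Sb adj) (adjs , All-cycEdges inS))) enc)

-- Staircase labellings

-- m is the number of vertices right of column c₀ in the second district.
module Staircase {n : ℕ} (c₀ : ℕ) (1≤c₀ : 1 ≤ c₀) (c₀+2≤n : suc (suc c₀) ≤ n) (φ : ℕ → Fin 3) (m : ℕ) where

  K : ℕ
  K = tri (suc c₀) + m

  rightLabel : ℕ → Fin 3
  rightLabel i = if i <ᵇ K then L₂ else L₃

  label : ℕ → ℕ → Fin 3
  label c r with <-cmp c c₀
  ... | tri< _ _ _ = L₁
  ... | tri≈ _ _ _ = φ r
  ... | tri> _ _ _ = rightLabel (tri c + r)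

  G : Labelling n
  G v = label (col v) (row v)

  D : Fin 3 → District n
  D = Dist G

  label-left : ∀ {c} r → c < c₀ → label c r ≡ L₁
  label-left {c} r lt with <-cmp c c₀
  ... | tri< _ _ _  = refl
  ... | tri≈ ¬lt _ _ = ⊥-elim (¬lt lt)
  ... | tri> ¬lt _ _ = ⊥-elim (¬lt lt)

  label-mid : ∀ {c} r → c ≡ c₀ → label c r ≡ φ r
  label-mid {c} r eq with <-cmp c c₀
  ... | tri< _ ¬eq _ = ⊥-elim (¬eq eq)
  ... | tri≈ _ _ _   = refl
  ... | tri> _ ¬eq _ = ⊥-elim (¬eq eq)

  label-right : ∀ {c} r → c₀ < c → label c r ≡ rightLabel (tri c + r)
  label-right {c} r gt with <-cmp c c₀
  ... | tri< _ _ ¬gt = ⊥-elim (¬gt gt)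
  ... | tri≈ _ _ ¬gt = ⊥-elim (¬gt gt)
  ... | tri> _ _ _   = refl

  rightLabel-< : ∀ {i} → i < K → rightLabel i ≡ L₂
  rightLabel-< {i} lt rewrite <⇒<ᵇ-true {i} {K} lt = refl

  rightLabel-≥ : ∀ {i} → K ≤ i → rightLabel i ≡ L₃
  rightLabel-≥ {i} ge rewrite ≥⇒<ᵇ-false {i} {K} ge = refl

  rightLabel≡L₂⇒< : ∀ {i} → rightLabel i ≡ L₂ → i < K
  rightLabel≡L₂⇒< {i} eq with i <ᵇ K in e
  ... | true = <ᵇ-true⇒< {i} {K} e

  rightLabel≡L₃⇒≥ : ∀ {i} → rightLabel i ≡ L₃ → K ≤ i
  rightLabel≡L₃⇒≥ {i} eq with i <ᵇ K in e
  ... | false = <ᵇ-false⇒≥ {i} {K} e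

  rightLabel≢L₁ : ∀ {i} → rightLabel i ≢ L₁
  rightLabel≢L₁ {i} eq with i <ᵇ K
  rightLabel≢L₁ () | true
  rightLabel≢L₁ () | false

  D-left : (v : V n) → col v < c₀ → D L₁ v
  D-left v = label-left (row v)

  D-right₂ : (v : V n) → c₀ < col v → rank v < K → D L₂ v
  D-right₂ v gt lt = trans (label-right (row v) gt) (rightLabel-< lt)

  D-right₃ : (v : V n) → c₀ < col v → K ≤ rank v → D L₃ v
  D-right₃ v gt ge = trans (label-right (row v) gt) (rightLabel-≥ ge)

  ¬D₁-right : (v : V n) → c₀ < col v → ¬ D L₁ v
  ¬D₁-right v gt eq = rightLabel≢L₁ (trans (sym (label-right (row v) gt)) eq)

  D≢L₁⇒c₀≤col : ∀ {j} (v : V n) → j ≢ L₁ → D j v → c₀ ≤ col v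
  D≢L₁⇒c₀≤col {j} v j≢L₁ Dv = ≮⇒≥ λ lt → j≢L₁ (trans (sym Dv) (D-left v lt))

  data ColumnCase (c : ℕ) : Set where
    leftOf  : c < c₀ → ColumnCase c
    middle  : c ≡ c₀ → ColumnCase c
    rightOf : c₀ < c → ColumnCase c

  columnCase : ∀ c → ColumnCase c
  columnCase c with <-cmp c c₀
  ... | tri< lt _ _ = leftOf lt
  ... | tri≈ _ eq _ = middle eq
  ... | tri> _ _ gt = rightOf gt

  c₀<n : c₀ < n
  c₀<n = ≤-trans (n≤1+n (suc c₀)) c₀+2≤n

  -- row r < m has its right neighbour in the second district, row r with m ≤ suc r its lower right one in the third
  L₂-Attached : Set
  L₂-Attached = ∀ r → r ≤ c₀ → φ r ≡ L₂ → r < m ⊎ ∃ λ r′ → r ≡ suc r′ × φ r′ ≡ L₂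

  L₃-Attached : Set
  L₃-Attached = ∀ r → r ≤ c₀ → φ r ≡ L₃ → m ≤ suc r

  D-middle : ∀ {j} (v : V n) → col v ≡ c₀ → φ (row v) ≡ j → D j v
  D-middle v eq φr = trans (label-mid (row v) eq) φr

  row≤c₀ : (v : V n) → col v ≡ c₀ → row v ≤ c₀
  row≤c₀ v eq = subst (row v ≤_) eq (row≤col v)

  rank-at : ∀ {w : V n} {c r} → col w ≡ c → row w ≡ r → rank w ≡ tri c + r
  rank-at refl refl = refl

  corner : VertexAt 0 0
  corner = vertexAt (≤-trans z<s c₀<n) z≤n

  path₁-fromLeft : (v : V n) → col v < c₀ → Path (D L₁) v (proj₁ corner)
  path₁-fromLeft v lt = path-viaTopRow (D L₁) v (proj₁ corner) (proj₂ (proj₂ corner)) (subst (_≤ col v) (sym (proj₁ (proj₂ corner))) z≤n)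
    (λ w ec _ → D-left w (subst (_< c₀) (sym ec) lt)) (λ w _ _ le → D-left w (≤-<-trans le lt))

  c′ : ℕ
  c′ = pred c₀

  c′+1≡c₀ : c′ + 1 ≡ c₀
  c′+1≡c₀ = trans (+-comm c′ 1) (suc-pred′ 1≤c₀)
    where suc-pred′ : ∀ {k} → 1 ≤ k → suc (pred k) ≡ k
          suc-pred′ (s≤s _) = refl

  c′<c₀ : c′ < c₀
  c′<c₀ = subst (c′ <_) c′+1≡c₀ (m<m+n c′ z<s)

  -- a vertex of column c₀ has a neighbour in column c₀ − 1, in the same row or, at the bottom, one row up
  path₁-fromMiddle : (v : V n) → col v ≡ c₀ → D L₁ v → Path (D L₁) v (proj₁ corner)
  path₁-fromMiddle v eq Dv with row v ≤? c′
  ... | yes r≤c′ =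
    let (w , cw , _ , adj) = predecessorAlong horizontal v (trans c′+1≡c₀ (sym eq)) (+-identityʳ (row v)) r≤c′
        w-left = subst (_< c₀) (sym cw) c′<c₀
    in (adj , Dv , D-left w w-left) ◅ path₁-fromLeft w w-left
  ... | no r≰c′ =
    let r≡c′+1 = ≤-antisym (subst (row v ≤_) (trans eq (sym c′+1≡c₀)) (row≤col v)) (subst (_≤ row v) (+-comm 1 c′) (≰⇒> r≰c′))
        (w , cw , _ , adj) = predecessorAlong diagonal v (trans c′+1≡c₀ (sym eq)) (sym r≡c′+1) ≤-refl
        w-left = subst (_< c₀) (sym cw) c′<c₀
    in (adj , Dv , D-left w w-left) ◅ path₁-fromLeft w w-left

  connected₁ : Connected (D L₁)
  connected₁ = connected-viaAnchor (D L₁) (proj₁ corner) λ v Dv → case v Dv (columnCase (col v))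
    where
    case : (v : V n) → D L₁ v → ColumnCase (col v) → Path (D L₁) v (proj₁ corner)
    case v Dv (leftOf lt)  = path₁-fromLeft v lt
    case v Dv (middle eq)  = path₁-fromMiddle v eq Dv
    case v Dv (rightOf gt) = ⊥-elim (¬D₁-right v gt Dv)

  anchor₂ : VertexAt (suc c₀) 0
  anchor₂ = vertexAt c₀+2≤n z≤n

  path₂-fromRight : (v : V n) → c₀ < col v → rank v < K → Path (D L₂) v (proj₁ anchor₂)
  path₂-fromRight v gt lt = path-viaTopRow (D L₂) v (proj₁ anchor₂) (proj₂ (proj₂ anchor₂)) (subst (_≤ col v) (sym (proj₁ (proj₂ anchor₂))) gt)
    (λ w ec le → D-right₂ w (subst (c₀ <_) (sym ec) gt) (≤-<-trans (rank-mono-row w v ec le) lt))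
    (λ w r≡0 ge le → D-right₂ w (subst (_≤ col w) (proj₁ (proj₂ anchor₂)) ge) (≤-<-trans (begin
       rank w            ≡⟨ rank-at refl r≡0 ⟩
       tri (col w) + 0   ≡⟨ +-identityʳ _ ⟩
       tri (col w)       ≤⟨ tri-mono-≤ le ⟩
       tri (col v)       ≤⟨ tri≤rank v ⟩
       rank v            ∎) lt))
    where open ≤-Reasoning

  path₂-fromMiddle : L₂-Attached → ∀ r (v : V n) → col v ≡ c₀ → row v ≡ r → φ r ≡ L₂ → Path (D L₂) v (proj₁ anchor₂)
  path₂-fromMiddle attached r v eq er φr with attached r (subst (_≤ c₀) er (row≤c₀ v eq)) φr
  ... | inj₁ r<m =
    let (w , cw , rw , adj) = successorAlong horizontal v (trans (+-comm (col v) 1) (cong suc eq)) (trans (+-identityʳ (row v)) er) c₀+2≤n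
                                (≤-trans (subst (_≤ c₀) er (row≤c₀ v eq)) (n≤1+n c₀))
        c₀<cw = subst (c₀ <_) (sym cw) (n<1+n c₀)
        rank<K = subst (_< K) (sym (rank-at cw rw)) (+-monoʳ-< (tri (suc c₀)) r<m)
    in (adj , D-middle v eq (trans (cong φ er) φr) , D-right₂ w c₀<cw rank<K) ◅ path₂-fromRight w c₀<cw rank<K
  ... | inj₂ (r′ , refl , φr′) =
    let (w , cw , rw , adj) = predecessorAlong vertical v (+-identityʳ (col v)) (trans (+-comm r′ 1) (sym er))
                                (≤-trans (n≤1+n r′) (subst (_≤ col v) er (row≤col v)))
        cw≡c₀ = trans cw eq
    in (adj , D-middle v eq (trans (cong φ er) φr) , D-middle w cw≡c₀ (trans (cong φ rw) φr′)) ◅ path₂-fromMiddle attached r′ w cw≡c₀ rw φr′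

  connected₂ : L₂-Attached → Connected (D L₂)
  connected₂ attached = connected-viaAnchor (D L₂) (proj₁ anchor₂) λ v Dv → case v Dv (columnCase (col v))
    where
    case : (v : V n) → D L₂ v → ColumnCase (col v) → Path (D L₂) v (proj₁ anchor₂)
    case v Dv (leftOf lt)  with () ← trans (sym Dv) (D-left v lt)
    case v Dv (middle eq)  = path₂-fromMiddle attached (row v) v eq refl (trans (sym (label-mid (row v) eq)) Dv)
    case v Dv (rightOf gt) = path₂-fromRight v gt (rightLabel≡L₂⇒< (trans (sym (label-right (row v) gt)) Dv))

  anchor₃ : VertexAt (pred n) (pred n)
  anchor₃ = vertexAt (pred<n (≤-trans z<s c₀+2≤n)) ≤-refl
    where pred<n : ∀ {k} → 0 < k → pred k < k
          pred<n (s≤s _) = ≤-refl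

  path₃-fromRight : (v : V n) → c₀ < col v → K ≤ rank v → Path (D L₃) v (proj₁ anchor₃)
  path₃-fromRight v gt ge =
    path-viaDiagonal (D L₃) v (proj₁ anchor₃) (trans (proj₂ (proj₂ anchor₃)) (sym (proj₁ (proj₂ anchor₃))))
      (subst (col v ≤_) (sym (proj₁ (proj₂ anchor₃))) (<⇒≤pred (col<n v)))
      (λ w ec le → D-right₃ w (subst (c₀ <_) (sym ec) gt) (≤-trans ge (rank-mono-row v w (sym ec) le)))
      (λ w rw≡cw le _ → D-right₃ w (<-≤-trans gt le) (≤-trans ge (rank≤rank-diagonal v w le rw≡cw)))

  path₃-fromMiddle : L₃-Attached → (v : V n) → col v ≡ c₀ → φ (row v) ≡ L₃ → Path (D L₃) v (proj₁ anchor₃)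
  path₃-fromMiddle attached v eq φr =
    let r≤c₀ = row≤c₀ v eq
        (w , cw , rw , adj) = successorAlong diagonal v (trans (+-comm (col v) 1) (cong suc eq)) (+-comm (row v) 1) c₀+2≤n (s≤s r≤c₀)
        c₀<cw = subst (c₀ <_) (sym cw) (n<1+n c₀)
        K≤rank = subst (K ≤_) (sym (rank-at cw rw)) (+-monoʳ-≤ (tri (suc c₀)) (attached (row v) r≤c₀ φr))
    in (adj , D-middle v eq φr , D-right₃ w c₀<cw K≤rank) ◅ path₃-fromRight w c₀<cw K≤rank

  connected₃ : L₃-Attached → Connected (D L₃)
  connected₃ attached = connected-viaAnchor (D L₃) (proj₁ anchor₃) λ v Dv → case v Dv (columnCase (col v))
    where
    case : (v : V n) → D L₃ v → ColumnCase (col v) → Path (D L₃) v (proj₁ anchor₃)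
    case v Dv (leftOf lt)  with () ← trans (sym Dv) (D-left v lt)
    case v Dv (middle eq)  = path₃-fromMiddle attached v eq (trans (sym (label-mid (row v) eq)) Dv)
    case v Dv (rightOf gt) = path₃-fromRight v gt (rightLabel≡L₃⇒≥ (trans (sym (label-right (row v) gt)) Dv))

  D? : ∀ j (v : V n) → Dec (D j v)
  D? j v = G v ≟F j

  D₁⇒col≤c₀ : (v : V n) → D L₁ v → col v ≤ c₀
  D₁⇒col≤c₀ v Dv = ≮⇒≥ λ gt → ¬D₁-right v gt Dv

  simplyConnected₁ : SimplyConnected (D L₁)
  simplyConnected₁ = simplyConnected-byRays (D L₁) (D? L₁) λ w ¬Dw →
    inj₁ λ v Dv → ≤-trans (D₁⇒col≤c₀ v Dv) (≮⇒≥ λ lt → ¬Dw (D-left w lt))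

  leftRayFree-upToMiddle : ∀ {j} → j ≢ L₁ → (w : V n) → col w ≤ c₀ → LeftRayFree (D j) w
  leftRayFree-upToMiddle j≢L₁ w le =
    (λ v Dv → ≤-trans le (≤-trans (D≢L₁⇒c₀≤col v j≢L₁ Dv) (n≤1+n _))) ,
    (λ h Dh (e , _) → <⇒≱ (subst (_≤ c₀) (sym e) le) (D≢L₁⇒c₀≤col h j≢L₁ Dh))

  rayFree-upToMiddle : ∀ {j} → j ≢ L₁ → (w : V n) → ¬ D j w → (c₀ < col w → RightRayFree (D j) w ⊎ LeftRayFree (D j) w) →
    RightRayFree (D j) w ⊎ LeftRayFree (D j) w
  rayFree-upToMiddle j≢L₁ w ¬Dw onRight with columnCase (col w)
  ... | leftOf lt  = inj₂ (leftRayFree-upToMiddle j≢L₁ w (<⇒≤ lt))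
  ... | middle eq  = inj₂ (leftRayFree-upToMiddle j≢L₁ w (≤-reflexive eq))
  ... | rightOf gt = onRight gt

  rightRayFree₂ : (w : V n) → c₀ < col w → K ≤ rank w → RightRayFree (D L₂) w
  rightRayFree₂ w gt K≤rank v Dv with columnCase (col v)
  ... | leftOf lt   = ≤-trans (<⇒≤ lt) (<⇒≤ gt)
  ... | middle eq   = ≤-trans (≤-reflexive eq) (<⇒≤ gt)
  ... | rightOf gt′ = rank<⇒col≤ v w (<-≤-trans (rightLabel≡L₂⇒< (trans (sym (label-right (row v) gt′)) Dv)) K≤rank)

  simplyConnected₂ : SimplyConnected (D L₂)
  simplyConnected₂ = simplyConnected-byRays (D L₂) (D? L₂) λ w ¬Dw →
    rayFree-upToMiddle (λ ()) w ¬Dw λ gt → inj₁ (rightRayFree₂ w gt (≮⇒≥ λ lt → ¬Dw (D-right₂ w gt lt)))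

  D₃-right⇒K≤ : (v : V n) → D L₃ v → c₀ < col v → K ≤ rank v
  D₃-right⇒K≤ v Dv gt = rightLabel≡L₃⇒≥ (trans (sym (label-right (row v) gt)) Dv)

  D₃-middle⇒K≤ : L₃-Attached → (v : V n) → D L₃ v → col v ≡ c₀ → K ≤ tri (suc c₀) + suc (row v)
  D₃-middle⇒K≤ attached v Dv eq = +-monoʳ-≤ (tri (suc c₀)) (attached (row v) (row≤c₀ v eq) (trans (sym (label-mid (row v) eq)) Dv))

  leftRayFree₃ : L₃-Attached → (w : V n) → rank w < K → LeftRayFree (D L₃) w
  leftRayFree₃ attached w rank<K = nearColumns , notBelowLeft
    where
    nearColumns : ∀ v → D L₃ v → col w ≤ suc (col v)
    nearColumns v Dv with columnCase (col v)
    ... | leftOf lt   with () ← trans (sym Dv) (D-left v lt)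
    ... | middle eq   = subst (λ c → col w ≤ suc c) (sym eq) (s≤s⁻¹ (rank<tri⇒col< w (<-≤-trans rank<K (begin
            K                               ≤⟨ D₃-middle⇒K≤ attached v Dv eq ⟩
            tri (suc c₀) + suc (row v)      ≤⟨ +-monoʳ-≤ (tri (suc c₀)) (s≤s (≤-trans (row≤c₀ v eq) (n≤1+n c₀))) ⟩
            tri (suc (suc c₀))              ∎))))
      where open ≤-Reasoning
    ... | rightOf gt  = ≤-trans (rank<⇒col≤ w v (<-≤-trans rank<K (D₃-right⇒K≤ v Dv gt))) (n≤1+n _)
    notBelowLeft : ∀ h → D L₃ h → ¬ (suc (col h) ≡ col w × suc (row h) ≡ row w)
    notBelowLeft h Dh (e₁ , e₂) with columnCase (col h)
    ... | leftOf lt   with () ← trans (sym Dh) (D-left h lt)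
    ... | middle eq   = <⇒≱ rank<K (subst (K ≤_) (sym (rank-at (trans (sym e₁) (cong suc eq)) (sym e₂))) (D₃-middle⇒K≤ attached h Dh eq))
    ... | rightOf gt  = <⇒≱ (<-≤-trans (rank<tri-suc h) (subst (λ c → tri c ≤ rank w) (sym e₁) (tri≤rank w)))
                             (<⇒≤ (<-≤-trans rank<K (D₃-right⇒K≤ h Dh gt)))

  simplyConnected₃ : L₃-Attached → SimplyConnected (D L₃)
  simplyConnected₃ attached = simplyConnected-byRays (D L₃) (D? L₃) λ w ¬Dw →
    rayFree-upToMiddle (λ ()) w ¬Dw λ gt → inj₂ (leftRayFree₃ attached w (≰⇒> λ ge → ¬Dw (D-right₃ w gt ge)))

  count : Fin 3 → ℕ
  count j = ∑ (suc c₀) (λ r → isLabel j (φ r))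

  columnSize : Fin 3 → ℕ → ℕ
  columnSize j c = ∑ (suc c) (λ r → isLabel j (label c r))

  rest : ℕ
  rest = n ∸ suc c₀

  size-byColumns : ∀ j → size G j ≡ ∑ c₀ (columnSize j) + count j + ∑ rest (λ k → columnSize j (suc c₀ + k))
  size-byColumns j = begin
    size G j                                                      ≡⟨ size-byCoords G label (λ _ → refl) j ⟩
    ∑ n (columnSize j)                                            ≡⟨ ∑-split (columnSize j) (<⇒≤ c₀+2≤n) ⟩
    ∑ (suc c₀) (columnSize j) + ∑ rest (λ k → columnSize j (suc c₀ + k))
                                                                  ≡⟨ cong (_+ ∑ rest (λ k → columnSize j (suc c₀ + k))) (∑-suc c₀ (columnSize j)) ⟩
    ∑ c₀ (columnSize j) + columnSize j c₀ + ∑ rest (λ k → columnSize j (suc c₀ + k))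
                                                                  ≡⟨ cong (λ x → ∑ c₀ (columnSize j) + x + ∑ rest (λ k → columnSize j (suc c₀ + k)))
                                                                          (∑-cong (suc c₀) λ r _ → cong (isLabel j) (label-mid r refl)) ⟩
    ∑ c₀ (columnSize j) + count j + ∑ rest (λ k → columnSize j (suc c₀ + k)) ∎
    where open ≡-Reasoning

  isLabel₁-rightLabel : ∀ i → isLabel L₁ (rightLabel i) ≡ 0
  isLabel₁-rightLabel i with i <ᵇ K
  ... | true  = refl
  ... | false = refl

  isLabel₂-rightLabel : ∀ i → isLabel L₂ (rightLabel i) ≡ bit (i <ᵇ K)
  isLabel₂-rightLabel i with i <ᵇ K
  ... | true  = refl
  ... | false = refl

  size₁ : size G L₁ ≡ tri c₀ + count L₁
  size₁ = begin
    size G L₁                                                          ≡⟨ size-byColumns L₁ ⟩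
    ∑ c₀ (columnSize L₁) + count L₁ + ∑ rest (λ k → columnSize L₁ (suc c₀ + k))
                                                                       ≡⟨ cong₂ (λ x y → x + count L₁ + y) leftColumns rightColumns ⟩
    tri c₀ + count L₁ + 0                                              ≡⟨ +-identityʳ _ ⟩
    tri c₀ + count L₁                                                  ∎
    where
    open ≡-Reasoning
    leftColumns : ∑ c₀ (columnSize L₁) ≡ tri c₀
    leftColumns = trans (∑-cong c₀ λ c c<c₀ → trans (∑-cong (suc c) λ r _ → cong (isLabel L₁) (label-left r c<c₀)) (∑-one (suc c)))
                 (∑-suc≡tri c₀)
    rightColumns : ∑ rest (λ k → columnSize L₁ (suc c₀ + k)) ≡ 0
    rightColumns = trans (∑-cong rest λ k _ → trans (∑-cong (suc (suc c₀ + k)) λ r _ →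
                    trans (cong (isLabel L₁) (label-right r (m≤m+n (suc c₀) k))) (isLabel₁-rightLabel _))
                  (∑-zero (suc (suc c₀ + k))))
                  (∑-zero rest)

  ranksBelowK : ℕ → ℕ
  ranksBelowK c = ∑ (suc c) (λ r → bit (tri c + r <ᵇ K))

  size₂ : K ≤ tri n → size G L₂ + tri (suc c₀) ≡ count L₂ + K
  size₂ K≤ = begin
    size G L₂ + tri (suc c₀)                                           ≡⟨ cong (_+ tri (suc c₀)) (size-byColumns L₂) ⟩
    ∑ c₀ (columnSize L₂) + count L₂ + ∑ rest (λ k → columnSize L₂ (suc c₀ + k)) + tri (suc c₀)
                                                                       ≡⟨ cong₂ (λ x y → x + count L₂ + y + tri (suc c₀)) leftColumns rightColumns ⟩
    0 + count L₂ + R + tri (suc c₀)                                    ≡⟨ +-assoc (count L₂) R (tri (suc c₀)) ⟩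
    count L₂ + (R + tri (suc c₀))                                      ≡⟨ cong (count L₂ +_) (+-comm R (tri (suc c₀))) ⟩
    count L₂ + (tri (suc c₀) + R)                                      ≡⟨ cong (λ x → count L₂ + (x + R)) first ⟨
    count L₂ + (∑ (suc c₀) ranksBelowK + R)                            ≡⟨ cong (count L₂ +_) (∑-split ranksBelowK (<⇒≤ c₀+2≤n)) ⟨
    count L₂ + ∑ n ranksBelowK                                         ≡⟨ cong (count L₂ +_) (trans (∑-ranksBelow K n) (m≤n⇒m⊓n≡m K≤)) ⟩
    count L₂ + K                                                       ∎
    where
    open ≡-Reasoning
    R : ℕ
    R = ∑ rest (λ k → ranksBelowK (suc c₀ + k))
    leftColumns : ∑ c₀ (columnSize L₂) ≡ 0
    leftColumns = trans (∑-cong c₀ λ c c<c₀ → trans (∑-cong (suc c) λ r _ → cong (isLabel L₂) (label-left r c<c₀)) (∑-zero (suc c)))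
                 (∑-zero c₀)
    rightColumns : ∑ rest (λ k → columnSize L₂ (suc c₀ + k)) ≡ R
    rightColumns = ∑-cong rest λ k _ → ∑-cong (suc (suc c₀ + k)) λ r _ →
              trans (cong (isLabel L₂) (label-right r (m≤m+n (suc c₀) k))) (isLabel₂-rightLabel _)
    first : ∑ (suc c₀) ranksBelowK ≡ tri (suc c₀)
    first = trans (∑-ranksBelow K (suc c₀)) (m≥n⇒m⊓n≡n (m≤m+n (tri (suc c₀)) m))

  balanced : (k : Fin 3 → ℕ) → L₂-Attached → L₃-Attached → K ≤ tri n →
    tri c₀ + count L₁ ≡ k L₁ → count L₂ + m ≡ k L₂ → k L₁ + k L₂ + k L₃ ≡ tri n → IsBalanced k G
  balanced k attached₂ attached₃ K≤ e₁ e₂ total = partition , sizes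
    where
    partition : IsPartition G
    partition L₁ = connected₁ , simplyConnected₁
    partition L₂ = connected₂ attached₂ , simplyConnected₂
    partition L₃ = connected₃ attached₃ , simplyConnected₃ attached₃
    s₁ : size G L₁ ≡ k L₁
    s₁ = trans size₁ e₁
    s₂ : size G L₂ ≡ k L₂
    s₂ = +-cancelʳ-≡ (tri (suc c₀)) _ _ (begin
      size G L₂ + tri (suc c₀)   ≡⟨ size₂ K≤ ⟩
      count L₂ + K               ≡⟨ cong (count L₂ +_) (+-comm (tri (suc c₀)) m) ⟩
      count L₂ + (m + tri (suc c₀)) ≡⟨ +-assoc (count L₂) m _ ⟨
      count L₂ + m + tri (suc c₀) ≡⟨ cong (_+ tri (suc c₀)) e₂ ⟩
      k L₂ + tri (suc c₀)        ∎)
      where open ≡-Reasoning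
    s₃ : size G L₃ ≡ k L₃
    s₃ = +-cancelˡ-≡ (k L₁ + k L₂) _ _
           (trans (cong₂ (λ x y → x + y + size G L₃) (sym s₁) (sym s₂))
             (trans (size-total G label (λ _ → refl)) (sym total)))
    sizes : ∀ j → size G j ≡ k j
    sizes L₁ = s₁
    sizes L₂ = s₂
    sizes L₃ = s₃

SameCells : Fin 3 → Fin 3 → Fin 3 → Set
SameCells j p q = (p ≡ j → q ≡ j) × (q ≡ j → p ≡ j)

SameCells-refl : ∀ {j p} → SameCells j p p
SameCells-refl = (λ e → e) , (λ e → e)

SameCells-neither : ∀ {j p q} → p ≢ j → q ≢ j → SameCells j p q
SameCells-neither p≢j q≢j = (λ e → ⊥-elim (p≢j e)) , (λ e → ⊥-elim (q≢j e))

module _ {n : ℕ} (c₀ : ℕ) (1≤c₀ : 1 ≤ c₀) (c₀+2≤n : suc (suc c₀) ≤ n) where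
  private module S = Staircase {n} c₀ 1≤c₀ c₀+2≤n

  staircases-agree : ∀ φ ψ m m′ j → (∀ r → r ≤ c₀ → SameCells j (φ r) (ψ r)) → j ≡ L₁ ⊎ m ≡ m′ →
    AgreeOn (S.G φ m) (S.G ψ m′) j
  staircases-agree φ ψ m m′ j middleAgree sameRight v with S.columnCase φ m (col v)
  ... | S.leftOf lt =
    (λ e → trans (S.label-left ψ m′ (row v) lt) (trans (sym (S.label-left φ m (row v) lt)) e)) ,
    (λ e → trans (S.label-left φ m (row v) lt) (trans (sym (S.label-left ψ m′ (row v) lt)) e))
  ... | S.middle eq =
    let (φ⇒ψ , ψ⇒φ) = middleAgree (row v) (S.row≤c₀ φ m v eq) in
    (λ e → trans (S.label-mid ψ m′ (row v) eq) (φ⇒ψ (trans (sym (S.label-mid φ m (row v) eq)) e))) ,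
    (λ e → trans (S.label-mid φ m (row v) eq) (ψ⇒φ (trans (sym (S.label-mid ψ m′ (row v) eq)) e)))
  ... | S.rightOf gt with sameRight
  ...   | inj₁ refl = (λ e → ⊥-elim (S.¬D₁-right φ m v gt e)) , (λ e → ⊥-elim (S.¬D₁-right ψ m′ v gt e))
  ...   | inj₂ refl =
    (λ e → trans (S.label-right ψ m (row v) gt) (trans (sym (S.label-right φ m (row v) gt)) e)) ,
    (λ e → trans (S.label-right φ m (row v) gt) (trans (sym (S.label-right ψ m (row v) gt)) e))

stripe : Bool → Bool → Bool → Fin 3
stripe a b c = if a then L₁ else if b then L₂ else if c then L₁ else L₃

stripe≡L₂⇒ : ∀ a b c → stripe a b c ≡ L₂ → a ≡ false × b ≡ true
stripe≡L₂⇒ false true  c     _ = refl , refl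
stripe≡L₂⇒ true  b     c     ()
stripe≡L₂⇒ false false true  ()
stripe≡L₂⇒ false false false ()

stripe≡L₃⇒ : ∀ a b c → stripe a b c ≡ L₃ → b ≡ false
stripe≡L₃⇒ false false false _ = refl
stripe≡L₃⇒ true  b     c     ()
stripe≡L₃⇒ false true  c     ()
stripe≡L₃⇒ false false true  ()

isLabel₁-stripe : ∀ a b c → (a ≡ true → b ≡ true) → isLabel L₁ (stripe a b c) ≡ bit a + (if b then 0 else bit c)
isLabel₁-stripe true  true  c     _  = refl
isLabel₁-stripe true  false c     a⇒b with () ← a⇒b refl
isLabel₁-stripe false true  c     _  = refl
isLabel₁-stripe false false true  _  = refl
isLabel₁-stripe false false false _  = refl

isLabel₂-stripe : ∀ a b c → (a ≡ true → b ≡ true) → isLabel L₂ (stripe a b c) + bit a ≡ bit b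
isLabel₂-stripe true  true  c     _  = refl
isLabel₂-stripe true  false c     a⇒b with () ← a⇒b refl
isLabel₂-stripe false true  c     _  = refl
isLabel₂-stripe false false true  _  = refl
isLabel₂-stripe false false false _  = refl

isLabel₁-stripe₀ : ∀ a b → isLabel L₁ (stripe a b false) ≡ bit a
isLabel₁-stripe₀ true  b     = refl
isLabel₁-stripe₀ false true  = refl
isLabel₁-stripe₀ false false = refl

isLabel₂-stripe₀ : ∀ a b → isLabel L₂ (stripe a b false) ≡ (if b then bit (not a) else 0)
isLabel₂-stripe₀ true  true  = refl
isLabel₂-stripe₀ true  false = refl
isLabel₂-stripe₀ false true  = refl
isLabel₂-stripe₀ false false = refl

stripe₀≡L₁ : ∀ a b → (stripe a b false ≡ L₁ → a ≡ true) × (a ≡ true → stripe a b false ≡ L₁)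
stripe₀≡L₁ true  b     = (λ _ → refl) , (λ _ → refl)
stripe₀≡L₁ false true  = (λ ()) , (λ ())
stripe₀≡L₁ false false = (λ ()) , (λ ())

stripe-L₃-moveThird : ∀ a b c → (a ≡ true → b ≡ true) → SameCells L₃ (stripe c b false) (stripe a b c)
stripe-L₃-moveThird true  true  c     _   = SameCells-neither (stripe-true≢L₃ c) (λ ())
  where stripe-true≢L₃ : ∀ c → stripe c true false ≢ L₃
        stripe-true≢L₃ true  ()
        stripe-true≢L₃ false ()
stripe-L₃-moveThird true  false c     a⇒b with () ← a⇒b refl
stripe-L₃-moveThird false true  true  _   = SameCells-neither (λ ()) (λ ())
stripe-L₃-moveThird false true  false _   = SameCells-neither (λ ()) (λ ())
stripe-L₃-moveThird false false true  _   = SameCells-refl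
stripe-L₃-moveThird false false false _   = SameCells-refl

stripe-L₂-third : ∀ a b c c′ → SameCells L₂ (stripe a b c) (stripe a b c′)
stripe-L₂-third true  b     c     c′    = SameCells-refl
stripe-L₂-third false true  c     c′    = SameCells-refl
stripe-L₂-third false false c     c′    = SameCells-neither (lemma c) (lemma c′)
  where lemma : ∀ c → stripe false false c ≢ L₂
        lemma true  ()
        lemma false ()

stripe-L₃-merge : ∀ a b c a′ → (a ≡ true → b ≡ true) → (b ≡ true → c ≡ true) → (a′ ≡ true → c ≡ true) →
  SameCells L₃ (stripe a b c) (stripe a′ c false)
stripe-L₃-merge a     b     true  a′    _   _   _   = SameCells-neither (lemma a b) (lemma′ a′)
  where lemma : ∀ a b → stripe a b true ≢ L₃
        lemma true  b     ()
        lemma false true  ()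
        lemma false false ()
        lemma′ : ∀ a′ → stripe a′ true false ≢ L₃
        lemma′ true  ()
        lemma′ false ()
stripe-L₃-merge a     true  false a′    _   b⇒c _   with () ← b⇒c refl
stripe-L₃-merge true  false false a′    a⇒b _   _   with () ← a⇒b refl
stripe-L₃-merge false false false true  _   _   a′⇒c with () ← a′⇒c refl
stripe-L₃-merge false false false false _   _   _   = SameCells-refl

stripe₀-L₁-second : ∀ a b b′ → SameCells L₁ (stripe a b false) (stripe a b′ false)
stripe₀-L₁-second true  b     b′    = SameCells-refl
stripe₀-L₁-second false b     b′    = SameCells-neither (lemma b) (lemma b′)
  where lemma : ∀ b → stripe false b false ≢ L₁
        lemma true  ()
        lemma false ()

-- Splitting the second district at a threshold

crossing-withStepsOf2 : (g : ℕ → ℕ) (N K : ℕ) → g 0 ≤ K → (∀ s → g (suc s) ≤ 2 + g s) →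
  ∃ λ u → u ≤ N × g u ≤ K × (u < N → K ≤ suc (g u))
crossing-withStepsOf2 g zero    K g0≤K steps = 0 , z≤n , g0≤K , λ ()
crossing-withStepsOf2 g (suc N) K g0≤K steps with crossing-withStepsOf2 g N K g0≤K steps
... | u , u≤N , gu≤K , below with m≤n⇒m<n∨m≡n u≤N
...   | inj₁ u<N = u , m≤n⇒m≤1+n u≤N , gu≤K , λ _ → below u<N
...   | inj₂ refl with K ≤? suc (g u)
...     | yes K≤ = u , m≤n⇒m≤1+n u≤N , gu≤K , λ _ → K≤
...     | no  K≰ = suc u , ≤-refl , ≤-trans (steps u) (≰⇒> K≰) , λ u<u → ⊥-elim (<-irrefl refl u<u)

threshold-split : (X : ℕ → Bool) (L K : ℕ) →
  ∃ λ u → ∃ λ m → u ≤ L × u ≤ m × (u < L → m ≤ suc u) × ∑ u (λ r → bit (not (X r))) + m ≡ K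
threshold-split X L K with crossing-withStepsOf2 (λ s → s + others s) L K z≤n steps
  where
  others : ℕ → ℕ
  others s = ∑ s (λ r → bit (not (X r)))
  steps : ∀ s → suc s + others (suc s) ≤ 2 + (s + others s)
  steps s = begin
    suc s + others (suc s)                ≡⟨ cong (suc s +_) (∑-suc s (λ r → bit (not (X r)))) ⟩
    suc s + (others s + bit (not (X s)))  ≤⟨ +-monoʳ-≤ (suc s) (+-monoʳ-≤ (others s) (bit≤1 (not (X s)))) ⟩
    suc s + (others s + 1)                ≡⟨ cong (suc s +_) (+-comm (others s) 1) ⟩
    suc s + suc (others s)                ≡⟨ +-suc (suc s) (others s) ⟩
    2 + (s + others s)                    ∎
    where
    open ≤-Reasoning
    bit≤1 : ∀ b → bit b ≤ 1
    bit≤1 true  = ≤-refl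
    bit≤1 false = z≤n
... | u , u≤L , u+others≤K , overshoot =
  u , K ∸ others , u≤L , m+n≤o⇒m≤o∸n u u+others≤K , m≤1+u , m+[n∸m]≡n (m+n≤o⇒n≤o u u+others≤K)
  where
  others : ℕ
  others = ∑ u (λ r → bit (not (X r)))
  m≤1+u : u < L → K ∸ others ≤ suc u
  m≤1+u u<L = ≤-trans (∸-monoˡ-≤ others (overshoot u<L)) (≤-reflexive (m+n∸n≡m (suc u) others))

-- The chain of recombination steps

module _ {n : ℕ} (P : Labelling n) {c₀ : ℕ} (c₀<n : c₀ < n) where

  inDistrict₁? : ∀ r → Dec (r ≤ c₀) → Bool
  inDistrict₁? r (yes r≤c₀) = does (P (proj₁ (vertexAt c₀<n r≤c₀)) ≟F L₁)
  inDistrict₁? r (no _)     = false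

  -- false for rows r > c₀, which lie outside the column
  inDistrict₁ : ℕ → Bool
  inDistrict₁ r = inDistrict₁? r (r ≤? c₀)

  inDistrict₁-spec : (v : V n) → col v ≡ c₀ → (inDistrict₁ (row v) ≡ true → P v ≡ L₁) × (P v ≡ L₁ → inDistrict₁ (row v) ≡ true)
  inDistrict₁-spec v eq with row v ≤? c₀
  ... | no r≰c₀ = ⊥-elim (r≰c₀ (subst (row v ≤_) eq (row≤col v)))
  ... | yes r≤c₀ rewrite vertexAt-≡ c₀<n r≤c₀ v eq refl with P v ≟F L₁
  ...   | yes Pv = (λ _ → Pv) , (λ _ → refl)
  ...   | no ¬Pv = (λ ()) , (λ Pv → ⊥-elim (¬Pv Pv))

+-rearrange : ∀ a b c d e → a + b + c + (d + e) ≡ (a + d) + (e + c) + b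
+-rearrange = solve-∀

module RecombinationChain {n : ℕ} (c₀ : ℕ) (1≤c₀ : 1 ≤ c₀) (c₀+2≤n : suc (suc c₀) ≤ n)
  (k : Fin 3 → ℕ) (n≤k : ∀ j → n ≤ k j) (total : k L₁ + k L₂ + k L₃ ≡ tri n)
  (P : Labelling n) (sizeP₁ : size P L₁ ≡ k L₁)
  (left⊆P₁ : ∀ v → col v < c₀ → P v ≡ L₁) (P₁⊆ : ∀ v → P v ≡ L₁ → col v ≤ c₀)
  (inP₁ : ℕ → Bool) (inP₁-spec : ∀ v → col v ≡ c₀ → (inP₁ (row v) ≡ true → P v ≡ L₁) × (P v ≡ L₁ → inP₁ (row v) ≡ true))
  (u m : ℕ) (u≤L : u ≤ suc c₀) (u≤m : u ≤ m) (m≤1+u : u < suc c₀ → m ≤ suc u)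
  (others+m≡k₂ : ∑ u (λ r → bit (not (inP₁ r))) + m ≡ k L₂) where

  module St (φ : ℕ → Fin 3) (m : ℕ) = Staircase {n} c₀ 1≤c₀ c₀+2≤n φ m
  open St using (G; L₂-Attached; L₃-Attached)

  L : ℕ
  L = suc c₀

  L<k : ∀ j → L < k j
  L<k j = ≤-trans c₀+2≤n (n≤k j)

  x : ℕ
  x = ∑ L (λ r → bit (inP₁ r))

  others : ℕ → ℕ
  others s = ∑ s (λ r → bit (not (inP₁ r)))

  t : ℕ
  t = ∑ u (λ r → bit (inP₁ r))

  x′ : ℕ
  x′ = ∑ (L ∸ u) (λ j → bit (inP₁ (u + j)))

  d : ℕ
  d = u + x′

  t+others≡u : t + others u ≡ u
  t+others≡u = ∑-bit+∑-bit-not u inP₁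

  x≡t+x′ : x ≡ t + x′
  x≡t+x′ = ∑-split (λ r → bit (inP₁ r)) u≤L

  t≤u : t ≤ u
  t≤u = subst (t ≤_) t+others≡u (m≤m+n t (others u))

  u≤d : u ≤ d
  u≤d = m≤m+n u x′

  d≤L : d ≤ L
  d≤L = subst (d ≤_) (m+[n∸m]≡n u≤L) (+-monoʳ-≤ u (∑-bit≤ (L ∸ u) (λ j → inP₁ (u + j))))

  x≤d : x ≤ d
  x≤d = subst (_≤ d) (sym x≡t+x′) (+-monoˡ-≤ x′ t≤u)

  x≤L : x ≤ L
  x≤L = ≤-trans x≤d d≤L

  others+x≡d : others u + x ≡ d
  others+x≡d = begin
    others u + x          ≡⟨ cong (others u +_) x≡t+x′ ⟩
    others u + (t + x′)   ≡⟨ +-assoc (others u) t x′ ⟨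
    others u + t + x′     ≡⟨ cong (_+ x′) (trans (+-comm (others u) t) t+others≡u) ⟩
    d                     ∎
    where open ≡-Reasoning

  x<m : x < m
  x<m = +-cancelˡ-< (others u) x m (begin-strict
    others u + x   ≡⟨ others+x≡d ⟩
    d              ≤⟨ d≤L ⟩
    L              <⟨ L<k L₂ ⟩
    k L₂           ≡⟨ others+m≡k₂ ⟨
    others u + m   ∎)
    where open ≤-Reasoning

  attached₂-above : ∀ ψ → (∀ r → ψ r ≡ L₂ → r < u) → L₂-Attached ψ m
  attached₂-above ψ above r _ ψr = inj₁ (<-≤-trans (above r ψr) u≤m)

  attached₃-below : ∀ ψ → (∀ r → ψ r ≡ L₃ → u ≤ r) → L₃-Attached ψ m
  attached₃-below ψ below r r≤c₀ ψr = ≤-trans (m≤1+u (s≤s (≤-trans (below r ψr) r≤c₀))) (s≤s (below r ψr))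

  attached₂-fromX : ∀ ψ m′ → x < m′ → (∀ r → ψ r ≡ L₂ → x ≤ r) → (∀ r → x ≤ r → ψ (suc r) ≡ L₂ → ψ r ≡ L₂) →
    L₂-Attached ψ m′
  attached₂-fromX ψ m′ x<m′ fromX stepUp r _ ψr with m≤n⇒m<n∨m≡n (fromX r ψr)
  ... | inj₂ refl = inj₁ x<m′
  ... | inj₁ x<r  = inj₂ (predecessor x<r ψr)
    where
    predecessor : ∀ {r} → x < r → ψ r ≡ L₂ → ∃ λ r′ → r ≡ suc r′ × ψ r′ ≡ L₂
    predecessor {suc r′} (s≤s x≤r′) ψr = r′ , refl , stepUp r′ x≤r′ ψr

  stripe-below-u : ∀ a c r → stripe a (r <ᵇ u) c ≡ L₂ → r < u
  stripe-below-u a c r eq = <ᵇ-true⇒< {r} {u} (proj₂ (stripe≡L₂⇒ a (r <ᵇ u) c eq))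

  stripe-above-u : ∀ a c r → stripe a (r <ᵇ u) c ≡ L₃ → u ≤ r
  stripe-above-u a c r eq = <ᵇ-false⇒≥ {r} {u} (stripe≡L₃⇒ a (r <ᵇ u) c eq)

  -- Column c₀ of the staircases visited: φ₁ keeps P₁ and puts P₂ above row u, P₃ below it; φ₂ lifts the
  -- t cells of P₁ above u to the top; φ₃ gathers the x′ cells of P₁ below u into rows u … d − 1; φ₄
  -- brings P₁ to the top; φσ is column c₀ of σ₁₂₃. Consecutive staircases share one district.
  φ₁ φ₂ φ₃ φ₄ φσ : ℕ → Fin 3
  φ₁ r = stripe (inP₁ r) (r <ᵇ u) false
  φ₂ r = stripe (r <ᵇ t) (r <ᵇ u) (inP₁ r)
  φ₃ r = stripe (r <ᵇ t) (r <ᵇ u) (r <ᵇ d)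
  φ₄ r = stripe (r <ᵇ x) (r <ᵇ d) false
  φσ r = stripe (r <ᵇ x) true false

  mσ : ℕ
  mσ = x + k L₂ ∸ L

  count : (ℕ → Fin 3) → Fin 3 → ℕ
  count ψ j = ∑ L (λ r → isLabel j (ψ r))

  <ᵇ-mono : ∀ {r a b} → a ≤ b → (r <ᵇ a) ≡ true → (r <ᵇ b) ≡ true
  <ᵇ-mono {r} {a} {b} a≤b e = <⇒<ᵇ-true (<-≤-trans (<ᵇ-true⇒< {r} {a} e) a≤b)

  ∑-pointwise : ∀ (f g h : ℕ → ℕ) → (∀ r → f r + g r ≡ h r) → ∑ L f + ∑ L g ≡ ∑ L h
  ∑-pointwise f g h e = trans (sym (∑-distrib-+ L f g)) (∑-cong L λ r _ → e r)

  count-φ₁-L₁ : count φ₁ L₁ ≡ x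
  count-φ₁-L₁ = ∑-cong L λ r _ → isLabel₁-stripe₀ (inP₁ r) (r <ᵇ u)

  count-φ₁-L₂ : count φ₁ L₂ ≡ others u
  count-φ₁-L₂ = trans (∑-cong L λ r _ → isLabel₂-stripe₀ (inP₁ r) (r <ᵇ u)) (∑-below (λ r → bit (not (inP₁ r))) u≤L)

  count-L₂-betweenTU : (c : ℕ → Bool) → count (λ r → stripe (r <ᵇ t) (r <ᵇ u) (c r)) L₂ ≡ others u
  count-L₂-betweenTU c = +-cancelʳ-≡ t _ _ (begin
    count (λ r → stripe (r <ᵇ t) (r <ᵇ u) (c r)) L₂ + t
      ≡⟨ cong (count (λ r → stripe (r <ᵇ t) (r <ᵇ u) (c r)) L₂ +_) (∑-bit-<ᵇ (≤-trans t≤u u≤L)) ⟨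
    count (λ r → stripe (r <ᵇ t) (r <ᵇ u) (c r)) L₂ + ∑ L (λ r → bit (r <ᵇ t))
      ≡⟨ ∑-pointwise (λ r → isLabel L₂ (stripe (r <ᵇ t) (r <ᵇ u) (c r))) (λ r → bit (r <ᵇ t)) (λ r → bit (r <ᵇ u))
                     (λ r → isLabel₂-stripe (r <ᵇ t) (r <ᵇ u) (c r) (<ᵇ-mono t≤u)) ⟩
    ∑ L (λ r → bit (r <ᵇ u))
      ≡⟨ ∑-bit-<ᵇ u≤L ⟩
    u ≡⟨ t+others≡u ⟨
    t + others u ≡⟨ +-comm t (others u) ⟩
    others u + t ∎)
    where open ≡-Reasoning

  count-L₁-topT : (c : ℕ → Bool) → count (λ r → stripe (r <ᵇ t) (r <ᵇ u) (c r)) L₁ ≡ t + ∑ (L ∸ u) (λ j → bit (c (u + j)))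
  count-L₁-topT c = begin
    count (λ r → stripe (r <ᵇ t) (r <ᵇ u) (c r)) L₁
      ≡⟨ ∑-cong L (λ r _ → isLabel₁-stripe (r <ᵇ t) (r <ᵇ u) (c r) (<ᵇ-mono t≤u)) ⟩
    ∑ L (λ r → bit (r <ᵇ t) + (if r <ᵇ u then 0 else bit (c r)))
      ≡⟨ ∑-distrib-+ L (λ r → bit (r <ᵇ t)) (λ r → if r <ᵇ u then 0 else bit (c r)) ⟩
    ∑ L (λ r → bit (r <ᵇ t)) + ∑ L (λ r → if r <ᵇ u then 0 else bit (c r))
      ≡⟨ cong₂ _+_ (∑-bit-<ᵇ (≤-trans t≤u u≤L)) (∑-from (λ r → bit (c r)) u≤L) ⟩
    t + ∑ (L ∸ u) (λ j → bit (c (u + j))) ∎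
    where open ≡-Reasoning

  count-φ₂-L₁ : count φ₂ L₁ ≡ x
  count-φ₂-L₁ = trans (count-L₁-topT inP₁) (sym x≡t+x′)

  count-φ₃-L₁ : count φ₃ L₁ ≡ x
  count-φ₃-L₁ = begin
    count φ₃ L₁                                   ≡⟨ count-L₁-topT (λ r → r <ᵇ d) ⟩
    t + ∑ (L ∸ u) (λ j → bit (u + j <ᵇ d))        ≡⟨ cong (t +_) (∑-countBelow d (L ∸ u) u) ⟩
    t + (L ∸ u) ⊓ (d ∸ u)                         ≡⟨ cong (λ y → t + (L ∸ u) ⊓ y) (m+n∸m≡n u x′) ⟩
    t + (L ∸ u) ⊓ x′                              ≡⟨ cong (t +_) (m≥n⇒m⊓n≡n (∑-bit≤ (L ∸ u) (λ j → inP₁ (u + j)))) ⟩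
    t + x′                                        ≡⟨ x≡t+x′ ⟨
    x                                             ∎
    where open ≡-Reasoning

  count-φ₄-L₁ : count φ₄ L₁ ≡ x
  count-φ₄-L₁ = trans (∑-cong L λ r _ → isLabel₁-stripe₀ (r <ᵇ x) (r <ᵇ d)) (∑-bit-<ᵇ x≤L)

  count-φ₄-L₂ : count φ₄ L₂ ≡ others u
  count-φ₄-L₂ = +-cancelʳ-≡ x _ _ (begin
    count φ₄ L₂ + x                               ≡⟨ cong (count φ₄ L₂ +_) (∑-bit-<ᵇ x≤L) ⟨
    count φ₄ L₂ + ∑ L (λ r → bit (r <ᵇ x))         ≡⟨ ∑-pointwise (λ r → isLabel L₂ (φ₄ r)) (λ r → bit (r <ᵇ x)) (λ r → bit (r <ᵇ d))
                                                       (λ r → isLabel₂-stripe (r <ᵇ x) (r <ᵇ d) false (<ᵇ-mono x≤d)) ⟩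
    ∑ L (λ r → bit (r <ᵇ d))                      ≡⟨ ∑-bit-<ᵇ d≤L ⟩
    d                                             ≡⟨ others+x≡d ⟨
    others u + x                                  ∎)
    where open ≡-Reasoning

  count-φσ-L₁ : count φσ L₁ ≡ x
  count-φσ-L₁ = trans (∑-cong L λ r _ → isLabel₁-stripe₀ (r <ᵇ x) true) (∑-bit-<ᵇ x≤L)

  count-φσ-L₂ : count φσ L₂ + x ≡ L
  count-φσ-L₂ = begin
    count φσ L₂ + x                               ≡⟨ cong (count φσ L₂ +_) (∑-bit-<ᵇ x≤L) ⟨
    count φσ L₂ + ∑ L (λ r → bit (r <ᵇ x))         ≡⟨ ∑-pointwise (λ r → isLabel L₂ (φσ r)) (λ r → bit (r <ᵇ x)) (λ _ → 1)
                                                       (λ r → isLabel₂-stripe (r <ᵇ x) true false (λ _ → refl)) ⟩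
    ∑ L (λ _ → 1)                                 ≡⟨ ∑-one L ⟩
    L                                             ∎
    where open ≡-Reasoning

  agree-P-Q₁ : AgreeOn P (G φ₁ m) L₁
  agree-P-Q₁ v with St.columnCase φ₁ m (col v)
  ... | St.leftOf lt  = (λ _ → St.label-left φ₁ m (row v) lt) , (λ _ → left⊆P₁ v lt)
  ... | St.middle eq  =
    let (inP₁⇒P , P⇒inP₁) = inP₁-spec v eq
        (Q⇒inP₁ , inP₁⇒Q) = stripe₀≡L₁ (inP₁ (row v)) (row v <ᵇ u)
    in (λ Pv → trans (St.label-mid φ₁ m (row v) eq) (inP₁⇒Q (P⇒inP₁ Pv))) ,
       (λ Qv → inP₁⇒P (Q⇒inP₁ (trans (sym (St.label-mid φ₁ m (row v) eq)) Qv)))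
  ... | St.rightOf gt = (λ Pv → ⊥-elim (<⇒≱ gt (P₁⊆ v Pv))) , (λ Qv → ⊥-elim (St.¬D₁-right φ₁ m v gt Qv))

  k₁≡ : k L₁ ≡ tri c₀ + x
  k₁≡ = begin
    k L₁                 ≡⟨ sizeP₁ ⟨
    size P L₁            ≡⟨ size-agree P (G φ₁ m) L₁ agree-P-Q₁ ⟩
    size (G φ₁ m) L₁     ≡⟨ St.size₁ φ₁ m ⟩
    tri c₀ + count φ₁ L₁ ≡⟨ cong (tri c₀ +_) count-φ₁-L₁ ⟩
    tri c₀ + x           ∎
    where open ≡-Reasoning

  tri-total : tri n ≡ (tri c₀ + x) + (others u + m) + k L₃
  tri-total = trans (sym total) (cong₂ (λ a b → a + b + k L₃) k₁≡ (sym others+m≡k₂))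

  K≤tri : tri (suc c₀) + m ≤ tri n
  K≤tri = begin
    tri c₀ + L + m                           ≤⟨ +-monoˡ-≤ m (+-monoʳ-≤ (tri c₀) (<⇒≤ (L<k L₃))) ⟩
    tri c₀ + k L₃ + m                        ≤⟨ m≤m+n _ (x + others u) ⟩
    tri c₀ + k L₃ + m + (x + others u)       ≡⟨ +-rearrange (tri c₀) (k L₃) m x (others u) ⟩
    (tri c₀ + x) + (others u + m) + k L₃     ≡⟨ tri-total ⟨
    tri n                                    ∎
    where open ≤-Reasoning

  balanced : ∀ ψ → L₂-Attached ψ m → L₃-Attached ψ m → count ψ L₁ ≡ x → count ψ L₂ ≡ others u → IsBalanced k (G ψ m)
  balanced ψ attached₂ attached₃ c₁ c₂ =
    St.balanced ψ m k attached₂ attached₃ K≤tri (trans (cong (tri c₀ +_) c₁) (sym k₁≡)) (trans (cong (_+ m) c₂) others+m≡k₂) total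

  balanced₁ : IsBalanced k (G φ₁ m)
  balanced₁ = balanced φ₁ (attached₂-above φ₁ λ r → stripe-below-u (inP₁ r) false r)
                          (attached₃-below φ₁ λ r → stripe-above-u (inP₁ r) false r) count-φ₁-L₁ count-φ₁-L₂

  balanced₂ : IsBalanced k (G φ₂ m)
  balanced₂ = balanced φ₂ (attached₂-above φ₂ λ r → stripe-below-u (r <ᵇ t) (inP₁ r) r)
                          (attached₃-below φ₂ λ r → stripe-above-u (r <ᵇ t) (inP₁ r) r) count-φ₂-L₁ (count-L₂-betweenTU inP₁)

  balanced₃ : IsBalanced k (G φ₃ m)
  balanced₃ = balanced φ₃ (attached₂-above φ₃ λ r → stripe-below-u (r <ᵇ t) (r <ᵇ d) r)
                          (attached₃-below φ₃ λ r → stripe-above-u (r <ᵇ t) (r <ᵇ d) r) count-φ₃-L₁ (count-L₂-betweenTU (λ r → r <ᵇ d))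

  balanced₄ : IsBalanced k (G φ₄ m)
  balanced₄ = balanced φ₄ (attached₂-fromX φ₄ m x<m fromX stepUp) (attached₃-below φ₄ below) count-φ₄-L₁ count-φ₄-L₂
    where
    fromX : ∀ r → φ₄ r ≡ L₂ → x ≤ r
    fromX r e = <ᵇ-false⇒≥ {r} {x} (proj₁ (stripe≡L₂⇒ (r <ᵇ x) (r <ᵇ d) false e))
    stepUp : ∀ r → x ≤ r → φ₄ (suc r) ≡ L₂ → φ₄ r ≡ L₂
    stepUp r x≤r e rewrite ≥⇒<ᵇ-false {r} {x} x≤r
                         | <⇒<ᵇ-true {r} {d} (<-trans (n<1+n r)
                             (<ᵇ-true⇒< {suc r} {d} (proj₂ (stripe≡L₂⇒ (suc r <ᵇ x) (suc r <ᵇ d) false e)))) = refl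
    below : ∀ r → φ₄ r ≡ L₃ → u ≤ r
    below r e = ≤-trans u≤d (<ᵇ-false⇒≥ {r} {d} (stripe≡L₃⇒ (r <ᵇ x) (r <ᵇ d) false e))

  x<mσ : x < mσ
  x<mσ = +-cancelʳ-< L x mσ (begin-strict
    x + L               <⟨ +-monoʳ-< x (L<k L₂) ⟩
    x + k L₂            ≡⟨ m∸n+n≡m (≤-trans (<⇒≤ (L<k L₂)) (m≤n+m (k L₂) x)) ⟨
    mσ + L              ∎)
    where open ≤-Reasoning

  Kσ≡ : tri (suc c₀) + mσ ≡ k L₁ + k L₂
  Kσ≡ = begin
    tri c₀ + L + mσ          ≡⟨ +-assoc (tri c₀) L mσ ⟩
    tri c₀ + (L + mσ)        ≡⟨ cong (tri c₀ +_) (m+[n∸m]≡n (≤-trans (<⇒≤ (L<k L₂)) (m≤n+m (k L₂) x))) ⟩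
    tri c₀ + (x + k L₂)      ≡⟨ +-assoc (tri c₀) x (k L₂) ⟨
    tri c₀ + x + k L₂        ≡⟨ cong (_+ k L₂) k₁≡ ⟨
    k L₁ + k L₂              ∎
    where open ≡-Reasoning

  balancedσ : IsBalanced k (G φσ mσ)
  balancedσ = St.balanced φσ mσ k (attached₂-fromX φσ mσ x<mσ fromX stepUp) noL₃
                (subst (_≤ tri n) (sym Kσ≡) (≤-trans (m≤m+n (k L₁ + k L₂) (k L₃)) (≤-reflexive total)))
                (trans (cong (tri c₀ +_) count-φσ-L₁) (sym k₁≡)) e₂ total
    where
    fromX : ∀ r → φσ r ≡ L₂ → x ≤ r
    fromX r e = <ᵇ-false⇒≥ {r} {x} (proj₁ (stripe≡L₂⇒ (r <ᵇ x) true false e))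
    stepUp : ∀ r → x ≤ r → φσ (suc r) ≡ L₂ → φσ r ≡ L₂
    stepUp r x≤r _ rewrite ≥⇒<ᵇ-false {r} {x} x≤r = refl
    noL₃ : L₃-Attached φσ mσ
    noL₃ r _ e = ⊥-elim (lemma (r <ᵇ x) e)
      where lemma : ∀ a → stripe a true false ≢ L₃
            lemma true  ()
            lemma false ()
    e₂ : count φσ L₂ + mσ ≡ k L₂
    e₂ = +-cancelˡ-≡ x _ _ (begin
      x + (count φσ L₂ + mσ)   ≡⟨ +-assoc x _ mσ ⟨
      x + count φσ L₂ + mσ     ≡⟨ cong (_+ mσ) (trans (+-comm x _) count-φσ-L₂) ⟩
      L + mσ                   ≡⟨ m+[n∸m]≡n (≤-trans (<⇒≤ (L<k L₂)) (m≤n+m (k L₂) x)) ⟩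
      x + k L₂                 ∎)
      where open ≡-Reasoning

  agree₁₂ : AgreeOn (G φ₁ m) (G φ₂ m) L₃
  agree₁₂ = staircases-agree c₀ 1≤c₀ c₀+2≤n φ₁ φ₂ m m L₃
    (λ r _ → stripe-L₃-moveThird (r <ᵇ t) (r <ᵇ u) (inP₁ r) (<ᵇ-mono t≤u)) (inj₂ refl)

  agree₂₃ : AgreeOn (G φ₂ m) (G φ₃ m) L₂
  agree₂₃ = staircases-agree c₀ 1≤c₀ c₀+2≤n φ₂ φ₃ m m L₂
    (λ r _ → stripe-L₂-third (r <ᵇ t) (r <ᵇ u) (inP₁ r) (r <ᵇ d)) (inj₂ refl)

  agree₃₄ : AgreeOn (G φ₃ m) (G φ₄ m) L₃
  agree₃₄ = staircases-agree c₀ 1≤c₀ c₀+2≤n φ₃ φ₄ m m L₃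
    (λ r _ → stripe-L₃-merge (r <ᵇ t) (r <ᵇ u) (r <ᵇ d) (r <ᵇ x) (<ᵇ-mono t≤u) (<ᵇ-mono u≤d) (<ᵇ-mono x≤d)) (inj₂ refl)

  agree₄σ : AgreeOn (G φ₄ m) (G φσ mσ) L₁
  agree₄σ = staircases-agree c₀ 1≤c₀ c₀+2≤n φ₄ φσ m mσ L₁
    (λ r _ → stripe₀-L₁-second (r <ᵇ x) (r <ᵇ d) true) (inj₁ refl)

  rank<k₁-left : (v : V n) → col v < c₀ → rank v < k L₁
  rank<k₁-left v lt = <-≤-trans (rank<tri-suc v) (≤-trans (tri-mono-≤ lt) (subst (tri c₀ ≤_) (sym k₁≡) (m≤m+n (tri c₀) x)))

  k₁≤rank-right : (v : V n) → c₀ < col v → k L₁ ≤ rank v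
  k₁≤rank-right v gt = begin
    k L₁           ≡⟨ k₁≡ ⟩
    tri c₀ + x     ≤⟨ +-monoʳ-≤ (tri c₀) x≤L ⟩
    tri (suc c₀)   ≤⟨ tri-mono-≤ gt ⟩
    tri (col v)    ≤⟨ tri≤rank v ⟩
    rank v         ∎
    where open ≤-Reasoning

  groundState : ∀ v → G φσ mσ v ≡ σ123 k v
  groundState v rewrite index≡rank v with St.columnCase φσ mσ (col v)
  ... | St.leftOf lt rewrite <⇒<ᵇ-true {rank v} {k L₁} (rank<k₁-left v lt) = St.label-left φσ mσ (row v) lt
  ... | St.rightOf gt rewrite ≥⇒<ᵇ-false {rank v} {k L₁} (k₁≤rank-right v gt) | sym Kσ≡ = St.label-right φσ mσ (row v) gt
  ... | St.middle eq = trans (St.label-mid φσ mσ (row v) eq) (cong₂ (λ a b → stripe a b false) (sym inP₁-rows) (sym (<⇒<ᵇ-true below₂)))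
    where
    rank≡ : rank v ≡ tri c₀ + row v
    rank≡ = cong (_+ row v) (cong tri eq)
    inP₁-rows : (rank v <ᵇ k L₁) ≡ (row v <ᵇ x)
    inP₁-rows = trans (cong₂ _<ᵇ_ rank≡ k₁≡) (<ᵇ-+-cancelˡ (tri c₀) (row v) x)
    below₂ : rank v < k L₁ + k L₂
    below₂ = begin-strict
      rank v                 ≡⟨ rank≡ ⟩
      tri c₀ + row v         <⟨ +-monoʳ-< (tri c₀) (s≤s (subst (row v ≤_) eq (row≤col v))) ⟩
      tri c₀ + L             ≤⟨ +-monoʳ-≤ (tri c₀) (≤-trans (<⇒≤ (L<k L₂)) (m≤n+m (k L₂) x)) ⟩
      tri c₀ + (x + k L₂)    ≡⟨ +-assoc (tri c₀) x (k L₂) ⟨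
      tri c₀ + x + k L₂      ≡⟨ cong (_+ k L₂) k₁≡ ⟨
      k L₁ + k L₂            ∎
      where open ≤-Reasoning

  toGroundState : ∃ λ Q → Star (RecomStep k) P Q × (∀ v → Q v ≡ σ123 k v)
  toGroundState = G φσ mσ ,
    (balanced₁ , L₁ , agree-P-Q₁) ◅ (balanced₂ , L₃ , agree₁₂) ◅ (balanced₃ , L₂ , agree₂₃) ◅
    (balanced₄ , L₃ , agree₃₄) ◅ (balancedσ , L₁ , agree₄σ) ◅ ε ,
    groundState

groundState-reachable : ∀ {n} (c₀ : ℕ) → 1 ≤ c₀ → suc (suc c₀) ≤ n →
  (k : Fin 3 → ℕ) → (∀ j → n ≤ k j) → k L₁ + k L₂ + k L₃ ≡ tri n →
  (P : Labelling n) → size P L₁ ≡ k L₁ → (∀ v → col v < c₀ → P v ≡ L₁) → (∀ v → P v ≡ L₁ → col v ≤ c₀) →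
  ∃ λ Q → Star (RecomStep k) P Q × (∀ v → Q v ≡ σ123 k v)
groundState-reachable {n} c₀ 1≤c₀ c₀+2≤n k n≤k total P sizeP₁ left⊆P₁ P₁⊆ = chain (threshold-split X (suc c₀) (k L₂))
  where
  c₀<n : c₀ < n
  c₀<n = <-trans (n<1+n c₀) c₀+2≤n
  X : ℕ → Bool
  X = inDistrict₁ P c₀<n
  chain : (∃ λ u → ∃ λ m → u ≤ suc c₀ × u ≤ m × (u < suc c₀ → m ≤ suc u) × ∑ u (λ r → bit (not (X r))) + m ≡ k L₂) →
    ∃ λ Q → Star (RecomStep k) P Q × (∀ v → Q v ≡ σ123 k v)
  chain (u , m , u≤L , u≤m , m≤1+u , split) =
    RecombinationChain.toGroundState c₀ 1≤c₀ c₀+2≤n k n≤k total P sizeP₁ left⊆P₁ P₁⊆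
      X (inDistrict₁-spec P c₀<n) u m u≤L u≤m m≤1+u split

district₁-inFirstColumn-impossible : ∀ {n} → 5 ≤ n → (k : Fin 3 → ℕ) → (∀ m → n ≤ k m) →
  (P : Labelling n) → size P L₁ ≡ k L₁ → ∀ i → i ≤ 1 → ¬ (∀ v → P v ≡ L₁ → InColsUpTo i v)
district₁-inFirstColumn-impossible 5≤n k n≤k P size≡ i i≤1 P₁⊆ =
  ¬district₁⊆firstColumn P (subst (2 ≤_) (sym size≡) (≤-trans (s≤s (s≤s z≤n)) (≤-trans 5≤n (n≤k L₁))))
    λ v Pv → n≤0⇒n≡0 (s≤s⁻¹ (≤-trans (P₁⊆ v Pv) i≤1))

lemma44 : (n : ℕ) → 5 ≤ n → (k : Fin 3 → ℕ) → (∀ m → n ≤ k m) →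
    2 * (k zero + k (fsuc zero) + k (fsuc (fsuc zero))) ≡ n * suc n →
    (P : Labelling n) → IsBalanced k P →
    (i : ℕ) → i ≤ n ∸ 2 →
    (∀ v → InColsBelow i v → P v ≡ zero) →
    (∀ v → P v ≡ zero → InColsUpTo i v) →
    ∃ (λ (Q : Labelling n) → Star (RecomStep k) P Q × (∀ v → Q v ≡ σ123 k v))
lemma44 n 5≤n k n≤k 2*sum≡ P (_ , sizes) 0 _ _ P₁⊆ =
  ⊥-elim (district₁-inFirstColumn-impossible 5≤n k n≤k P (sizes L₁) 0 z≤n P₁⊆)
lemma44 n 5≤n k n≤k 2*sum≡ P (_ , sizes) 1 _ _ P₁⊆ =
  ⊥-elim (district₁-inFirstColumn-impossible 5≤n k n≤k P (sizes L₁) 1 ≤-refl P₁⊆)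
-- C_i is the column with 0-based index c₀ = i − 1
lemma44 n 5≤n k n≤k 2*sum≡ P (_ , sizes) i@(suc c₀@(suc _)) i≤n∸2 left⊆P₁ P₁⊆ =
  groundState-reachable c₀ (s≤s z≤n) c₀+2≤n k n≤k total P (sizes L₁) (λ v lt → left⊆P₁ v (s≤s lt)) (λ v Pv → s≤s⁻¹ (P₁⊆ v Pv))
  where
  c₀+2≤n : suc i ≤ n
  c₀+2≤n = ≤-trans (n≤1+n (suc i)) (subst (_≤ n) (+-comm i 2) (m≤o∸n⇒m+n≤o i (≤-trans (s≤s (s≤s z≤n)) 5≤n) i≤n∸2))
  total : k L₁ + k L₂ + k L₃ ≡ tri n
  total = *-cancelʳ-≡ _ _ 2 (trans (*-comm (k L₁ + k L₂ + k L₃) 2) (trans 2*sum≡ (sym (tri*2 n))))
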